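{- Let $2\leq k\in\mathbb{N}$ and let $\mathbf{X}$ be a loopless digraph. Then $\mathrm{BA}^k(\mathbf{X},\mathbf{K}_{(k^2+k)/2})=\textsc{Yes}$.
   Context: Digraphs are finite; loopless means no edge of the form $(x,x)$. $\mathbf{K}_n$ is the digraph on $[n]=\{1,\dots,n\}$ whose edges are all pairs of distinct elements. For a tuple $\mathbf{z}=(z_1,\dots,z_m)$ and $\mathbf{i}=(i_1,\dots,i_p)\in[m]^p$, $\mathbf{z}_{\mathbf{i}}=(z_{i_1},\dots,z_{i_p})$. For tuples $\mathbf{s},\mathbf{t}$ of equal length $k$, $\mathbf{s}\prec\mathbf{t}$ means $s_i=s_j\Rightarrow t_i=t_j$ for all $i,j$; $\not\prec$ is its negation. For digraphs $\mathbf{X},\mathbf{A}$ and $k\geq2$, take variables $\lambda_{\mathbf{x},\mathbf{a}}$ ($\mathbf{x}\in V(\mathbf{X})^k,\mathbf{a}\in V(\mathbf{A})^k$), $\mu_{\mathbf{y},\mathbf{b}}$ ($\mathbf{y}\in E(\mathbf{X}),\mathbf{b}\in E(\mathbf{A})$) and equations: (1) $\sum_{\mathbf{a}}\lambda_{\mathbf{x},\mathbf{a}}=1$; (2) $\sum_{\hat{\mathbf{a}}:\hat{\mathbf{a}}_{\mathbf{i}}=\mathbf{a}}\lambda_{\mathbf{x},\hat{\mathbf{a}}}=\lambda_{\mathbf{x}_{\mathbf{i}},\mathbf{a}}$ for all $\mathbf{x},\mathbf{a}$ and $\mathbf{i}\in[k]^k$; (3) $\sum_{\mathbf{b}\in E(\mathbf{A}):\mathbf{b}_{\mathbf{i}}=\mathbf{a}}\mu_{\mathbf{y},\mathbf{b}}=\lambda_{\mathbf{y}_{\mathbf{i}},\mathbf{a}}$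 for all $\mathbf{y}\in E(\mathbf{X}),\mathbf{a}$ and $\mathbf{i}\in[2]^k$; (4) $\lambda_{\mathbf{x},\mathbf{a}}=0$ if $\mathbf{x}\not\prec\mathbf{a}$; (5) $\mu_{\mathbf{y},\mathbf{b}}=0$ if $\mathbf{y}\not\prec\mathbf{b}$. $\mathrm{BA}^k(\mathbf{X},\mathbf{A})=\textsc{Yes}$ means the system has a nonnegative rational solution and an integer solution such that every variable equal to $0$ in the rational solution is $0$ in the integer solution. -}

module Defs where

open import Data.Nat using (ℕ; zero; suc)
open import Data.Bool using (Bool; true; false; not)
open import Data.Fin using (Fin; zero; suc)
import Data.Fin as F
open import Data.Vec using (Vec; []; _∷_; lookup)
import Data.Vec as V
import Data.Vec.Properties as VP
open import Data.List using (List; [_]; map; concatMap; filter; foldr)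
open import Data.List using () renaming (allFin to allFinL)
open import Data.Product using (Σ; _×_; _,_)
open import Relation.Nullary using (¬_; Dec)
open import Relation.Nullary.Decidable using (⌊_⌋; _×-dec_)
open import Relation.Binary.PropositionalEquality using (_≡_)
open import Data.Rational as ℚ using (ℚ; 0ℚ; 1ℚ)
open import Data.Integer as ℤ using (ℤ)
import Data.Bool.Properties as BP

record Digraph : Set where
  field
    size : ℕ
    edge : Fin size → Fin size → Bool
open Digraph public

Vtx : Digraph → Set
Vtx G = Fin (size G)

Tuple : Digraph → ℕ → Set
Tuple G k = Vec (Vtx G) k

IsEdge : (G : Digraph) → Tuple G 2 → Set
IsEdge G b = edge G (lookup b zero) (lookup b (suc zero)) ≡ true

isEdge? : (G : Digraph) (b : Tuple G 2) → Dec (IsEdge G b)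
isEdge? G b = edge G (lookup b zero) (lookup b (suc zero)) BP.≟ true

Loopless : Digraph → Set
Loopless G = ∀ (x : Vtx G) → edge G x x ≡ false

K : ℕ → Digraph
K n = record { size = n ; edge = λ x y → not ⌊ x F.≟ y ⌋ }

allTuples : (n k : ℕ) → List (Vec (Fin n) k)
allTuples n zero = [ [] ]
allTuples n (suc k) = concatMap (λ a → map (a ∷_) (allTuples n k)) (allFinL n)

sel : ∀ {A : Set} {m p} → Vec A m → Vec (Fin m) p → Vec A p
sel z i = V.map (lookup z) i

_≺_ : ∀ {A B : Set} {k} → Vec A k → Vec B k → Set
s ≺ t = ∀ i j → lookup s i ≡ lookup s j → lookup t i ≡ lookup t j

sel≡? : ∀ {n m p} (i : Vec (Fin m) p) (a : Vec (Fin n) p) (â : Vec (Fin n) m) → Dec (sel â i ≡ a)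
sel≡? i a â = VP.≡-dec F._≟_ (sel â i) a

-- The BA^k system over a number type R (with +, 0, 1).
-- lam x a  stands for λ_{x,a};  mu y b  for μ_{y,b} (only meaningful for edges y, b).
module System (R : Set) (_+_ : R → R → R) (0# 1# : R) where

  Σ' : List R → R
  Σ' = foldr _+_ 0#

  record Solves (k : ℕ) (X A : Digraph)
                (lam : Tuple X k → Tuple A k → R)
                (mu : Tuple X 2 → Tuple A 2 → R) : Set where
    field
      eq1 : ∀ (x : Tuple X k) → Σ' (map (lam x) (allTuples (size A) k)) ≡ 1#
      eq2 : ∀ (x : Tuple X k) (a : Tuple A k) (i : Vec (Fin k) k) →
            Σ' (map (lam x) (filter (sel≡? i a) (allTuples (size A) k))) ≡ lam (sel x i) a
      eq3 : ∀ (y : Tuple X 2) → IsEdge X y → ∀ (a : Tuple A k) (i : Vec (Fin 2) k) →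
            Σ' (map (mu y) (filter (λ b → isEdge? A b ×-dec sel≡? i a b) (allTuples (size A) 2)))
              ≡ lam (sel y i) a
      eq4 : ∀ (x : Tuple X k) (a : Tuple A k) → ¬ (x ≺ a) → lam x a ≡ 0#
      eq5 : ∀ (y : Tuple X 2) (b : Tuple A 2) → IsEdge X y → IsEdge A b → ¬ (y ≺ b) → mu y b ≡ 0#

open System public using (Solves)

BA-Yes : ℕ → Digraph → Digraph → Set
BA-Yes k X A =
  Σ (Tuple X k → Tuple A k → ℚ) λ lamQ →
  Σ (Tuple X 2 → Tuple A 2 → ℚ) λ muQ →
  Σ (Tuple X k → Tuple A k → ℤ) λ lamZ →
  Σ (Tuple X 2 → Tuple A 2 → ℤ) λ muZ →
    Solves ℚ ℚ._+_ 0ℚ 1ℚ k X A lamQ muQ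
  × (∀ x a → 0ℚ ℚ.≤ lamQ x a)
  × (∀ y b → IsEdge X y → IsEdge A b → 0ℚ ℚ.≤ muQ y b)
  × Solves ℤ ℤ._+_ (ℤ.+ 0) (ℤ.+ 1) k X A lamZ muZ
  × (∀ x a → lamQ x a ≡ 0ℚ → lamZ x a ≡ ℤ.+ 0)
  × (∀ y b → IsEdge X y → IsEdge A b → muQ y b ≡ 0ℚ → muZ y b ≡ ℤ.+ 0)

-- A solution comes from a weighting of the words over [n]: a function W, vanishing on words
-- with a repeated letter, such that summing W over all ways of inserting one letter at a fixed
-- place of a word c gives back W c.  Then λ_{x,a} is the W-weight of the words c with c ∘ g = a,
-- where g is the order pattern of x: the tuple ordered like x whose values form an initial
-- segment of ℕ.
-- Selecting coordinates of x changes the pattern only by unused values, which the insertion law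
-- sums out, so the equations hold; μ is the same construction for pairs, and a pair that is not
-- an edge of K_n repeats a letter, while an edge of the loopless X never does.
-- The uniform weighting of injective words is rational and nonnegative.  An integer weighting
-- is obtained by inclusion-exclusion over marker values triangular m + i at the positions i of
-- words of length m + 1; the markers for all lengths up to k fit into [n] when n ≥ (k² + k)/2.
-- The uniform weighting vanishes only on words with a repeated letter, where the integer one
-- vanishes too, which gives the support condition.

module Submission where

open import Level using (0ℓ)
open import Algebra.Bundles using (CommutativeRing)
open import Algebra.Core using (Op₁; Op₂)
open import Algebra.Structures using (IsCommutativeRing)
import Algebra.Properties.CommutativeSemigroup as CommutativeSemigroupProperties
import Algebra.Properties.Ring as RingProperties
open import Data.Bool using (true; false)
open import Data.Empty using (⊥-elim)
open import Data.Fin using (Fin; zero; suc; toℕ; punchIn; punchOut; fromℕ<)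
import Data.Fin as Fin
import Data.Fin.Properties as Finₚ
open import Data.Integer using (ℤ)
import Data.Integer as ℤ
import Data.Integer.Properties as ℤₚ
open import Data.List using (List; []; _∷_; _++_; [_]; length; map; concatMap; filter; foldr; tabulate)
  renaming (allFin to allFinL)
import Data.List.Properties as Listₚ
open import Data.List.Membership.Propositional using (_∈_; lose)
open import Data.List.Membership.Propositional.Properties using (∈-++⁺ˡ; ∈-++⁺ʳ; ∈-++⁻)
import Data.List.Membership.DecPropositional as DecMembership
open import Data.List.Relation.Unary.All using (All; []; _∷_)
import Data.List.Relation.Unary.All as All
open import Data.List.Relation.Unary.Any using (Any; here; there)
import Data.List.Relation.Unary.Any as Any
import Data.List.Relation.Unary.Any.Properties as Anyₚ
open import Data.Nat using (ℕ; zero; suc; _≤_; _<_; z≤n; s≤s; _∸_; _≟_; _≤?_)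
import Data.Nat as ℕ
open import Data.Nat.DivMod using (m*n/n≡m)
import Data.Nat.Properties as ℕₚ
open import Data.Nat.Solver using (module +-*-Solver)
open import Data.Product using (∃; _×_; _,_; proj₁; proj₂)
open import Data.Rational using (ℚ; 0ℚ; 1ℚ; 1/_; NonNegative; Positive)
import Data.Rational as ℚ
import Data.Rational.Properties as ℚₚ
open import Data.Sum using (_⊎_; inj₁; inj₂; [_,_]′)
open import Data.Vec using (Vec; []; _∷_; lookup; toList)
import Data.Vec as Vec
import Data.Vec.Properties as Vecₚ
open import Function using (_∘_; _⇔_; mk⇔; Equivalence)
open import Function.Properties.Equivalence using (⇔-isEquivalence)
open import Relation.Binary.PropositionalEquality
  using (_≡_; _≢_; refl; sym; trans; cong; cong₂; subst; subst₂; module ≡-Reasoning)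
open import Relation.Binary.Structures using (IsEquivalence)
open import Relation.Nullary using (Dec; yes; no; ¬_)
open import Relation.Nullary.Decidable using (_×-dec_; ¬?)

open import Defs

module Summation {A : Set} {plus times : Op₂ A} {negate : Op₁ A} {zero′ one′ : A}
                 (isCommutativeRing : IsCommutativeRing _≡_ plus times negate zero′ one′) where

  commutativeRing : CommutativeRing 0ℓ 0ℓ
  commutativeRing = record { isCommutativeRing = isCommutativeRing }

  open CommutativeRing commutativeRing public
    using (_+_; _*_; -_; _-_; 0#; 1#; +-assoc; +-comm; +-identityˡ; +-identityʳ; -‿inverseʳ;
           *-comm; *-assoc; *-identityˡ; *-identityʳ; zeroˡ; zeroʳ; distribˡ)
  open CommutativeRing commutativeRing using (ring; +-commutativeSemigroup)
  open RingProperties ring public using (-0#≈0#; -‿involutive; -‿+-comm; xyx⁻¹≈y)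
  open CommutativeSemigroupProperties +-commutativeSemigroup public using (interchange; xy∙z≈xz∙y)

  x-0≡x : ∀ x → x - 0# ≡ x
  x-0≡x x = trans (cong (x +_) -0#≈0#) (+-identityʳ x)

  -- Unfolds to the sum Σ' (map f xs) in which Defs states the equations.
  ∑ : ∀ {B : Set} → List B → (B → A) → A
  ∑ xs f = foldr _+_ 0# (map f xs)

  ∑-cong : ∀ {B : Set} (xs : List B) {f g : B → A} → (∀ x → f x ≡ g x) → ∑ xs f ≡ ∑ xs g
  ∑-cong []       f≗g = refl
  ∑-cong (x ∷ xs) f≗g = cong₂ _+_ (f≗g x) (∑-cong xs f≗g)

  ∑-++ : ∀ {B : Set} (xs ys : List B) (f : B → A) → ∑ (xs ++ ys) f ≡ ∑ xs f + ∑ ys f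
  ∑-++ []       ys f = sym (+-identityˡ _)
  ∑-++ (x ∷ xs) ys f = trans (cong (f x +_) (∑-++ xs ys f)) (sym (+-assoc _ _ _))

  ∑-map : ∀ {B C : Set} (h : B → C) (xs : List B) (f : C → A) → ∑ (map h xs) f ≡ ∑ xs (f ∘ h)
  ∑-map h []       f = refl
  ∑-map h (x ∷ xs) f = cong (f (h x) +_) (∑-map h xs f)

  ∑-concatMap : ∀ {B C : Set} (g : B → List C) (xs : List B) (f : C → A) →
                ∑ (concatMap g xs) f ≡ ∑ xs (λ x → ∑ (g x) f)
  ∑-concatMap g []       f = refl
  ∑-concatMap g (x ∷ xs) f =
    trans (∑-++ (g x) (concatMap g xs) f) (cong (∑ (g x) f +_) (∑-concatMap g xs f))

  ∑-+ : ∀ {B : Set} (xs : List B) (f g : B → A) → ∑ xs (λ x → f x + g x) ≡ ∑ xs f + ∑ xs g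
  ∑-+ []       f g = sym (+-identityˡ 0#)
  ∑-+ (x ∷ xs) f g = trans (cong ((f x + g x) +_) (∑-+ xs f g)) (interchange (f x) (g x) _ _)

  ∑-*ˡ : ∀ {B : Set} (xs : List B) (c : A) (f : B → A) → ∑ xs (λ x → c * f x) ≡ c * ∑ xs f
  ∑-*ˡ []       c f = sym (zeroʳ c)
  ∑-*ˡ (x ∷ xs) c f = trans (cong ((c * f x) +_) (∑-*ˡ xs c f)) (sym (distribˡ c (f x) _))

  ∑-*ʳ : ∀ {B : Set} (xs : List B) (c : A) (f : B → A) → ∑ xs (λ x → f x * c) ≡ ∑ xs f * c
  ∑-*ʳ xs c f = trans (∑-cong xs (λ x → *-comm (f x) c)) (trans (∑-*ˡ xs c f) (*-comm c _))

  ∑-zero : ∀ {B : Set} (xs : List B) {f : B → A} → (∀ x → f x ≡ 0#) → ∑ xs f ≡ 0#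
  ∑-zero []       f≡0 = refl
  ∑-zero (x ∷ xs) f≡0 = trans (cong₂ _+_ (f≡0 x) (∑-zero xs f≡0)) (+-identityˡ 0#)

  ∑-neg : ∀ {B : Set} (xs : List B) (f : B → A) → ∑ xs (λ x → - f x) ≡ - ∑ xs f
  ∑-neg []       f = sym -0#≈0#
  ∑-neg (x ∷ xs) f = trans (cong ((- f x) +_) (∑-neg xs f)) (-‿+-comm (f x) _)

  ∑-sub : ∀ {B : Set} (xs : List B) (f g : B → A) → ∑ xs (λ x → f x - g x) ≡ ∑ xs f - ∑ xs g
  ∑-sub xs f g = trans (∑-+ xs f _) (cong (∑ xs f +_) (∑-neg xs g))

  ∑-sub-*ˡ : ∀ {B : Set} (xs : List B) (c : A) (f g : B → A) →
             ∑ xs (λ x → f x - c * g x) ≡ ∑ xs f - c * ∑ xs g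
  ∑-sub-*ˡ xs c f g = trans (∑-sub xs f _) (cong (λ s → ∑ xs f - s) (∑-*ˡ xs c g))

  ∑-comm : ∀ {B C : Set} (xs : List B) (ys : List C) (f : B → C → A) →
           ∑ xs (λ x → ∑ ys (f x)) ≡ ∑ ys (λ y → ∑ xs (λ x → f x y))
  ∑-comm []       ys f = sym (∑-zero ys (λ _ → refl))
  ∑-comm (x ∷ xs) ys f = trans (cong (∑ ys (f x) +_) (∑-comm xs ys f))
                               (sym (∑-+ ys (f x) (λ y → ∑ xs (λ x′ → f x′ y))))

  𝟙 : ∀ {P : Set} → Dec P → A
  𝟙 (yes _) = 1#
  𝟙 (no _)  = 0#

  𝟙-cong : ∀ {P Q : Set} (p : Dec P) (q : Dec Q) → (P → Q) → (Q → P) → 𝟙 p ≡ 𝟙 q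
  𝟙-cong (yes _) (yes _) _   _   = refl
  𝟙-cong (yes p) (no ¬q) P→Q _   = ⊥-elim (¬q (P→Q p))
  𝟙-cong (no ¬p) (yes q) _   Q→P = ⊥-elim (¬p (Q→P q))
  𝟙-cong (no _)  (no _)  _   _   = refl

  𝟙-yes : ∀ {P : Set} (p : Dec P) → P → 𝟙 p ≡ 1#
  𝟙-yes (yes _) _ = refl
  𝟙-yes (no ¬p) p = ⊥-elim (¬p p)

  𝟙-no : ∀ {P : Set} (p : Dec P) → ¬ P → 𝟙 p ≡ 0#
  𝟙-no (yes p) ¬p = ⊥-elim (¬p p)
  𝟙-no (no _)  _  = refl

  𝟙-× : ∀ {P Q : Set} (p : Dec P) (q : Dec Q) → 𝟙 (p ×-dec q) ≡ 𝟙 p * 𝟙 q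
  𝟙-× (yes _) (yes _) = sym (*-identityˡ 1#)
  𝟙-× (yes _) (no _)  = sym (*-identityˡ 0#)
  𝟙-× (no _)  (yes _) = sym (zeroˡ 1#)
  𝟙-× (no _)  (no _)  = sym (zeroˡ 0#)

  𝟙-¬ : ∀ {P : Set} (p : Dec P) → 𝟙 (¬? p) ≡ 1# - 𝟙 p
  𝟙-¬ (yes _) = sym (-‿inverseʳ 1#)
  𝟙-¬ (no _)  = sym (trans (cong (1# +_) -0#≈0#) (+-identityʳ 1#))

  ∑-filter : ∀ {B : Set} {P : B → Set} (P? : ∀ x → Dec (P x)) (xs : List B) (f : B → A) →
             ∑ (filter P? xs) f ≡ ∑ xs (λ x → 𝟙 (P? x) * f x)
  ∑-filter P? []       f = refl
  ∑-filter P? (x ∷ xs) f with P? x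
  ... | yes _ = cong₂ _+_ (sym (*-identityˡ (f x))) (∑-filter P? xs f)
  ... | no _  = trans (sym (+-identityˡ _)) (cong₂ _+_ (sym (zeroˡ (f x))) (∑-filter P? xs f))

  ∑-tabulate : ∀ {B : Set} n (g : Fin n → B) (f : B → A) → ∑ (tabulate g) f ≡ ∑ (allFinL n) (f ∘ g)
  ∑-tabulate zero    g f = refl
  ∑-tabulate (suc n) g f =
    cong (f (g zero) +_) (trans (∑-tabulate n (g ∘ suc) f) (sym (∑-tabulate n suc (f ∘ g))))

  ∑-allFin-suc : ∀ n (f : Fin (suc n) → A) → ∑ (allFinL (suc n)) f ≡ f zero + ∑ (allFinL n) (f ∘ suc)
  ∑-allFin-suc n f = cong (f zero +_) (∑-tabulate n suc f)

  ∑-allFin-point : ∀ n (u : Fin n) (u≟ : ∀ v → Dec (u ≡ v)) (h : Fin n → A) →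
                   ∑ (allFinL n) (λ v → 𝟙 (u≟ v) * h v) ≡ h u
  ∑-allFin-point (suc n) zero u≟ h = begin
    ∑ (allFinL (suc n)) (λ v → 𝟙 (u≟ v) * h v)
      ≡⟨ ∑-allFin-suc n _ ⟩
    𝟙 (u≟ zero) * h zero + ∑ (allFinL n) (λ v → 𝟙 (u≟ (suc v)) * h (suc v))
      ≡⟨ cong₂ _+_ (trans (cong (_* h zero) (𝟙-yes (u≟ zero) refl)) (*-identityˡ _))
                   (∑-zero (allFinL n) (λ v → trans (cong (_* h (suc v)) (𝟙-no (u≟ (suc v)) λ ())) (zeroˡ _))) ⟩
    h zero + 0#
      ≡⟨ +-identityʳ _ ⟩
    h zero ∎
    where open ≡-Reasoning
  ∑-allFin-point (suc n) (suc u) u≟ h = begin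
    ∑ (allFinL (suc n)) (λ v → 𝟙 (u≟ v) * h v)
      ≡⟨ ∑-allFin-suc n _ ⟩
    𝟙 (u≟ zero) * h zero + ∑ (allFinL n) (λ v → 𝟙 (u≟ (suc v)) * h (suc v))
      ≡⟨ cong₂ _+_ (trans (cong (_* h zero) (𝟙-no (u≟ zero) λ ())) (zeroˡ _))
                   (∑-cong (allFinL n) λ v →
                     cong (_* h (suc v)) (𝟙-cong (u≟ (suc v)) (u Finₚ.≟ v) Finₚ.suc-injective (cong suc))) ⟩
    0# + ∑ (allFinL n) (λ v → 𝟙 (u Finₚ.≟ v) * h (suc v))
      ≡⟨ +-identityˡ _ ⟩
    ∑ (allFinL n) (λ v → 𝟙 (u Finₚ.≟ v) * h (suc v))
      ≡⟨ ∑-allFin-point n u (u Finₚ.≟_) (h ∘ suc) ⟩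
    h (suc u) ∎
    where open ≡-Reasoning

  ∑-allTuples-suc : ∀ n k (f : Vec (Fin n) (suc k) → A) →
                    ∑ (allTuples n (suc k)) f ≡ ∑ (allFinL n) (λ v → ∑ (allTuples n k) (λ e → f (v ∷ e)))
  ∑-allTuples-suc n k f = trans (∑-concatMap (λ a → map (a ∷_) (allTuples n k)) (allFinL n) f)
                                (∑-cong (allFinL n) (λ v → ∑-map (v ∷_) (allTuples n k) f))

  _≟ᵥ_ : ∀ {n k} (s t : Vec (Fin n) k) → Dec (s ≡ t)
  _≟ᵥ_ = Vecₚ.≡-dec Finₚ._≟_

  ∑-allTuples-point : ∀ n k (t : Vec (Fin n) k) (h : Vec (Fin n) k → A) →
                      ∑ (allTuples n k) (λ a → 𝟙 (t ≟ᵥ a) * h a) ≡ h t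
  ∑-allTuples-point n zero    []       h = trans (cong (_+ 0#) (trans (cong (_* h []) (𝟙-yes (_≟ᵥ_ {n} [] []) refl)) (*-identityˡ _)))
                                                 (+-identityʳ _)
  ∑-allTuples-point n (suc k) (t₀ ∷ t) h = begin
    ∑ (allTuples n (suc k)) (λ a → 𝟙 ((t₀ ∷ t) ≟ᵥ a) * h a)
      ≡⟨ ∑-allTuples-suc n k _ ⟩
    ∑ (allFinL n) (λ v → ∑ (allTuples n k) (λ e → 𝟙 ((t₀ ∷ t) ≟ᵥ (v ∷ e)) * h (v ∷ e)))
      ≡⟨ ∑-cong (allFinL n) (λ v → ∑-cong (allTuples n k) (λ e → split v e)) ⟩
    ∑ (allFinL n) (λ v → ∑ (allTuples n k) (λ e → 𝟙 (t₀ Finₚ.≟ v) * (𝟙 (t ≟ᵥ e) * h (v ∷ e))))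
      ≡⟨ ∑-cong (allFinL n) (λ v → trans (∑-*ˡ (allTuples n k) _ _)
                                         (cong (𝟙 (t₀ Finₚ.≟ v) *_) (∑-allTuples-point n k t _))) ⟩
    ∑ (allFinL n) (λ v → 𝟙 (t₀ Finₚ.≟ v) * h (v ∷ t))
      ≡⟨ ∑-allFin-point n t₀ (t₀ Finₚ.≟_) (λ v → h (v ∷ t)) ⟩
    h (t₀ ∷ t) ∎
    where
      open ≡-Reasoning
      split : ∀ v e → 𝟙 ((t₀ ∷ t) ≟ᵥ (v ∷ e)) * h (v ∷ e) ≡ 𝟙 (t₀ Finₚ.≟ v) * (𝟙 (t ≟ᵥ e) * h (v ∷ e))
      split v e = begin
        𝟙 ((t₀ ∷ t) ≟ᵥ (v ∷ e)) * h (v ∷ e)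
          ≡⟨ cong (_* h (v ∷ e)) (𝟙-cong ((t₀ ∷ t) ≟ᵥ (v ∷ e)) ((t₀ Finₚ.≟ v) ×-dec (t ≟ᵥ e))
                                         Vecₚ.∷-injective (λ { (refl , refl) → refl })) ⟩
        𝟙 ((t₀ Finₚ.≟ v) ×-dec (t ≟ᵥ e)) * h (v ∷ e)
          ≡⟨ cong (_* h (v ∷ e)) (𝟙-× (t₀ Finₚ.≟ v) (t ≟ᵥ e)) ⟩
        𝟙 (t₀ Finₚ.≟ v) * 𝟙 (t ≟ᵥ e) * h (v ∷ e)
          ≡⟨ *-assoc _ _ _ ⟩
        𝟙 (t₀ Finₚ.≟ v) * (𝟙 (t ≟ᵥ e) * h (v ∷ e)) ∎

  ∑-allTuples-insertAt : ∀ n m (q : Fin (suc m)) (f : Vec (Fin n) (suc m) → A) →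
    ∑ (allTuples n (suc m)) f ≡ ∑ (allFinL n) (λ v → ∑ (allTuples n m) (λ e → f (Vec.insertAt e q v)))
  ∑-allTuples-insertAt n m       zero    f = ∑-allTuples-suc n m f
  ∑-allTuples-insertAt n (suc m) (suc q) f = begin
    ∑ (allTuples n (suc (suc m))) f
      ≡⟨ ∑-allTuples-suc n (suc m) f ⟩
    ∑ (allFinL n) (λ w → ∑ (allTuples n (suc m)) (λ c → f (w ∷ c)))
      ≡⟨ ∑-cong (allFinL n) (λ w → ∑-allTuples-insertAt n m q (λ c → f (w ∷ c))) ⟩
    ∑ (allFinL n) (λ w → ∑ (allFinL n) (λ v → ∑ (allTuples n m) (λ e → f (w ∷ Vec.insertAt e q v))))
      ≡⟨ ∑-comm (allFinL n) (allFinL n) _ ⟩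
    ∑ (allFinL n) (λ v → ∑ (allFinL n) (λ w → ∑ (allTuples n m) (λ e → f (Vec.insertAt (w ∷ e) (suc q) v))))
      ≡⟨ ∑-cong (allFinL n) (λ v → sym (∑-allTuples-suc n m (λ e → f (Vec.insertAt e (suc q) v)))) ⟩
    ∑ (allFinL n) (λ v → ∑ (allTuples n (suc m)) (λ e → f (Vec.insertAt e (suc q) v))) ∎
    where open ≡-Reasoning

insertAtℕ : ∀ {B : Set} → List B → ℕ → B → List B
insertAtℕ xs       zero    v = v ∷ xs
insertAtℕ []       (suc q) v = v ∷ []
insertAtℕ (x ∷ xs) (suc q) v = x ∷ insertAtℕ xs q v

toList-insertAt : ∀ {B : Set} {m} (e : Vec B m) (q : Fin (suc m)) v →
                  toList (Vec.insertAt e q v) ≡ insertAtℕ (toList e) (toℕ q) v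
toList-insertAt e       zero    v = refl
toList-insertAt (x ∷ e) (suc q) v = cong (x ∷_) (toList-insertAt e q v)

length-insertAtℕ : ∀ {B : Set} (b : List B) q v → length (insertAtℕ b q v) ≡ suc (length b)
length-insertAtℕ b       zero    v = refl
length-insertAtℕ []      (suc q) v = refl
length-insertAtℕ (y ∷ b) (suc q) v = cong suc (length-insertAtℕ b q v)

data HasDup {B : Set} : List B → Set where
  here  : ∀ {x xs} → x ∈ xs → HasDup (x ∷ xs)
  there : ∀ {x xs} → HasDup xs → HasDup (x ∷ xs)

HasDup-++-∷ : ∀ {B : Set} (b : List B) x a → HasDup (b ++ x ∷ a) → HasDup (b ++ a) ⊎ (x ∈ b ⊎ x ∈ a)
HasDup-++-∷ []      x a (here x∈a)  = inj₂ (inj₂ x∈a)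
HasDup-++-∷ []      x a (there dup) = inj₁ dup
HasDup-++-∷ (y ∷ b) x a (here y∈b++x∷a) with ∈-++⁻ b y∈b++x∷a
... | inj₁ y∈b         = inj₁ (here (∈-++⁺ˡ y∈b))
... | inj₂ (here y≡x)  = inj₂ (inj₁ (here (sym y≡x)))
... | inj₂ (there y∈a) = inj₁ (here (∈-++⁺ʳ b y∈a))
HasDup-++-∷ (y ∷ b) x a (there dup) with HasDup-++-∷ b x a dup
... | inj₁ dup′        = inj₁ (there dup′)
... | inj₂ (inj₁ x∈b)  = inj₂ (inj₁ (there x∈b))
... | inj₂ (inj₂ x∈a)  = inj₂ (inj₂ x∈a)

∈-insertAtℕ⁺ : ∀ {B : Set} {z : B} (b : List B) q v → z ∈ b → z ∈ insertAtℕ b q v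
∈-insertAtℕ⁺ b       zero    v z∈b         = there z∈b
∈-insertAtℕ⁺ (x ∷ b) (suc q) v (here z≡x)  = here z≡x
∈-insertAtℕ⁺ (x ∷ b) (suc q) v (there z∈b) = there (∈-insertAtℕ⁺ b q v z∈b)

∈-insertAtℕ : ∀ {B : Set} (b : List B) q v → v ∈ insertAtℕ b q v
∈-insertAtℕ b       zero    v = here refl
∈-insertAtℕ []      (suc q) v = here refl
∈-insertAtℕ (x ∷ b) (suc q) v = there (∈-insertAtℕ b q v)

∈-insertAtℕ⁻ : ∀ {B : Set} {z : B} (b : List B) q v → z ∈ insertAtℕ b q v → z ∈ b ⊎ z ≡ v
∈-insertAtℕ⁻ b       zero    v (here z≡v)  = inj₂ z≡v
∈-insertAtℕ⁻ b       zero    v (there z∈b) = inj₁ z∈b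
∈-insertAtℕ⁻ []      (suc q) v (here z≡v)  = inj₂ z≡v
∈-insertAtℕ⁻ (x ∷ b) (suc q) v (here z≡x)  = inj₁ (here z≡x)
∈-insertAtℕ⁻ (x ∷ b) (suc q) v (there z∈) with ∈-insertAtℕ⁻ b q v z∈
... | inj₁ z∈b = inj₁ (there z∈b)
... | inj₂ z≡v = inj₂ z≡v

HasDup-insertAtℕ⁺ : ∀ {B : Set} (b : List B) q v → HasDup b → HasDup (insertAtℕ b q v)
HasDup-insertAtℕ⁺ b       zero    v dup         = there dup
HasDup-insertAtℕ⁺ (x ∷ b) (suc q) v (here x∈b)  = here (∈-insertAtℕ⁺ b q v x∈b)
HasDup-insertAtℕ⁺ (x ∷ b) (suc q) v (there dup) = there (HasDup-insertAtℕ⁺ b q v dup)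

∈⇒HasDup-insertAtℕ : ∀ {B : Set} (b : List B) q v → v ∈ b → HasDup (insertAtℕ b q v)
∈⇒HasDup-insertAtℕ b       zero    v v∈b         = here v∈b
∈⇒HasDup-insertAtℕ (x ∷ b) (suc q) v (here v≡x)  = here (subst (_∈ insertAtℕ b q v) v≡x (∈-insertAtℕ b q v))
∈⇒HasDup-insertAtℕ (x ∷ b) (suc q) v (there v∈b) = there (∈⇒HasDup-insertAtℕ b q v v∈b)

HasDup-insertAtℕ⁻ : ∀ {B : Set} (b : List B) q v → HasDup (insertAtℕ b q v) → HasDup b ⊎ v ∈ b
HasDup-insertAtℕ⁻ b       zero    v (here v∈b)  = inj₂ v∈b
HasDup-insertAtℕ⁻ b       zero    v (there dup) = inj₁ dup
HasDup-insertAtℕ⁻ []      (suc q) v (here ())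
HasDup-insertAtℕ⁻ []      (suc q) v (there ())
HasDup-insertAtℕ⁻ (x ∷ b) (suc q) v (here x∈) with ∈-insertAtℕ⁻ b q v x∈
... | inj₁ x∈b = inj₁ (here x∈b)
... | inj₂ x≡v = inj₂ (here (sym x≡v))
HasDup-insertAtℕ⁻ (x ∷ b) (suc q) v (there dup) with HasDup-insertAtℕ⁻ b q v dup
... | inj₁ dup′ = inj₁ (there dup′)
... | inj₂ v∈b  = inj₂ (there v∈b)

∈-toList : ∀ {B : Set} {m} (c : Vec B m) i → lookup c i ∈ toList c
∈-toList (x ∷ c) zero    = here refl
∈-toList (x ∷ c) (suc i) = there (∈-toList c i)

lookup-repeat⇒HasDup : ∀ {B : Set} {m} (c : Vec B m) {i j : Fin m} →
                        i ≢ j → lookup c i ≡ lookup c j → HasDup (toList c)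
lookup-repeat⇒HasDup (x ∷ c) {zero}  {zero}  i≢j _  = ⊥-elim (i≢j refl)
lookup-repeat⇒HasDup (x ∷ c) {zero}  {suc j} _   eq = here (subst (_∈ toList c) (sym eq) (∈-toList c j))
lookup-repeat⇒HasDup (x ∷ c) {suc i} {zero}  _   eq = here (subst (_∈ toList c) eq (∈-toList c i))
lookup-repeat⇒HasDup (x ∷ c) {suc i} {suc j} i≢j eq = there (lookup-repeat⇒HasDup c (i≢j ∘ cong suc) eq)

lookup-extensional : ∀ {B : Set} {p} {u w : Vec B p} → (∀ i → lookup u i ≡ lookup w i) → u ≡ w
lookup-extensional {u = u} {w} u≗w =
  trans (sym (Vecₚ.tabulate∘lookup u)) (trans (Vecₚ.tabulate-cong u≗w) (Vecₚ.tabulate∘lookup w))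

lookup-sel : ∀ {B : Set} {m p} (z : Vec B m) (i : Vec (Fin m) p) j → lookup (sel z i) j ≡ lookup z (lookup i j)
lookup-sel z i j = Vecₚ.lookup-map j (lookup z) i

sel-sel : ∀ {B : Set} {m p r} (z : Vec B m) (g : Vec (Fin m) p) (i : Vec (Fin p) r) →
          sel (sel z g) i ≡ sel z (sel g i)
sel-sel z g i = trans (Vecₚ.map-cong (lookup-sel z g) i) (Vecₚ.map-∘ (lookup z) (lookup g) i)

sel-insertAt-punchIn : ∀ {B : Set} {m p} (e : Vec B m) q v (g : Vec (Fin m) p) →
                       sel (Vec.insertAt e q v) (Vec.map (punchIn q) g) ≡ sel e g
sel-insertAt-punchIn e q v g = lookup-extensional λ j → begin
  lookup (sel (Vec.insertAt e q v) (Vec.map (punchIn q) g)) j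
    ≡⟨ lookup-sel (Vec.insertAt e q v) (Vec.map (punchIn q) g) j ⟩
  lookup (Vec.insertAt e q v) (lookup (Vec.map (punchIn q) g) j)
    ≡⟨ cong (lookup (Vec.insertAt e q v)) (Vecₚ.lookup-map j (punchIn q) g) ⟩
  lookup (Vec.insertAt e q v) (punchIn q (lookup g j))
    ≡⟨ Vecₚ.insertAt-punchIn e q v (lookup g j) ⟩
  lookup e (lookup g j)
    ≡⟨ lookup-sel e g j ⟨
  lookup (sel e g) j ∎
  where open ≡-Reasoning

record SameOrder {a b p} (g : Vec (Fin a) p) (h : Vec (Fin b) p) : Set where
  constructor sameOrder
  field ≤⇔≤ : ∀ i j → lookup g i Fin.≤ lookup g j ⇔ lookup h i Fin.≤ lookup h j
open SameOrder

module ⇔ = IsEquivalence (⇔-isEquivalence {ℓ = 0ℓ})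

sameOrder-refl : ∀ {a p} (g : Vec (Fin a) p) → SameOrder g g
sameOrder-refl g = sameOrder λ i j → ⇔.refl

sameOrder-sym : ∀ {a b p} {g : Vec (Fin a) p} {h : Vec (Fin b) p} → SameOrder g h → SameOrder h g
sameOrder-sym g∼h = sameOrder λ i j → ⇔.sym (≤⇔≤ g∼h i j)

sameOrder-trans : ∀ {a b c p} {g : Vec (Fin a) p} {h : Vec (Fin b) p} {k : Vec (Fin c) p} →
                  SameOrder g h → SameOrder h k → SameOrder g k
sameOrder-trans g∼h h∼k = sameOrder λ i j → ⇔.trans (≤⇔≤ g∼h i j) (≤⇔≤ h∼k i j)

sameOrder-sel : ∀ {a b p r} {g : Vec (Fin a) p} {h : Vec (Fin b) p} (i : Vec (Fin p) r) →
                SameOrder g h → SameOrder (sel g i) (sel h i)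
sameOrder-sel {g = g} {h} i g∼h = sameOrder λ j j′ →
  subst₂ (λ u w → (u Fin.≤ w) ⇔ (lookup (sel h i) j Fin.≤ lookup (sel h i) j′)) (sym (lookup-sel g i j)) (sym (lookup-sel g i j′))
    (subst₂ (λ u w → (lookup g (lookup i j) Fin.≤ lookup g (lookup i j′)) ⇔ (u Fin.≤ w)) (sym (lookup-sel h i j)) (sym (lookup-sel h i j′))
      (≤⇔≤ g∼h (lookup i j) (lookup i j′)))

sameOrder⇒≺ : ∀ {a b p} {g : Vec (Fin a) p} {h : Vec (Fin b) p} → SameOrder g h → g ≺ h
sameOrder⇒≺ g∼h i j eq = Finₚ.≤-antisym (Equivalence.to (≤⇔≤ g∼h i j) (Finₚ.≤-reflexive eq))
                                        (Equivalence.to (≤⇔≤ g∼h j i) (Finₚ.≤-reflexive (sym eq)))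

Onto : ∀ {m p} → Vec (Fin m) p → Set
Onto {m} g = ∀ (v : Fin m) → ∃ λ j → lookup g j ≡ v

onto-or-gap : ∀ {m p} (g : Vec (Fin m) p) → Onto g ⊎ ∃ λ q → ∀ j → lookup g j ≢ q
onto-or-gap {m} g with Finₚ.all? (λ v → Finₚ.any? (λ j → lookup g j Finₚ.≟ v))
... | yes onto = inj₁ onto
... | no ¬onto with Finₚ.¬∀⟶∃¬ m _ (λ v → Finₚ.any? (λ j → lookup g j Finₚ.≟ v)) ¬onto
...   | q , q∉g = inj₂ (q , λ j eq → q∉g (j , eq))

onto⇒≤ : ∀ {m p} (g : Vec (Fin m) p) → Onto g → m ≤ p
onto⇒≤ {m} {p} g onto with m ℕ.≤? p
... | yes m≤p = m≤p
... | no m≰p with Finₚ.pigeonhole (ℕₚ.≰⇒> m≰p) (proj₁ ∘ onto)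
...   | i , j , i<j , eq = ⊥-elim (Finₚ.<⇒≢ i<j (trans (sym (proj₂ (onto i))) (trans (cong (lookup g) eq) (proj₂ (onto j)))))

punchOutAll : ∀ {m p} (g : Vec (Fin (suc m)) p) q → (∀ j → lookup g j ≢ q) → Vec (Fin m) p
punchOutAll g q q∉g = Vec.tabulate (λ j → punchOut (q∉g j ∘ sym))

punchIn-punchOutAll : ∀ {m p} (g : Vec (Fin (suc m)) p) q q∉g j →
                      punchIn q (lookup (punchOutAll g q q∉g) j) ≡ lookup g j
punchIn-punchOutAll g q q∉g j =
  trans (cong (punchIn q) (Vecₚ.lookup∘tabulate _ j)) (Finₚ.punchIn-punchOut (q∉g j ∘ sym))

map-punchIn-punchOutAll : ∀ {m p} (g : Vec (Fin (suc m)) p) q q∉g →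
                          Vec.map (punchIn q) (punchOutAll g q q∉g) ≡ g
map-punchIn-punchOutAll g q q∉g = lookup-extensional λ j →
  trans (Vecₚ.lookup-map j (punchIn q) (punchOutAll g q q∉g)) (punchIn-punchOutAll g q q∉g j)

punchOutAll-sameOrder : ∀ {m p} (g : Vec (Fin (suc m)) p) q q∉g → SameOrder (punchOutAll g q q∉g) g
punchOutAll-sameOrder g q q∉g = sameOrder λ i j → mk⇔
  (λ le → subst₂ Fin._≤_ (punchIn-punchOutAll g q q∉g i) (punchIn-punchOutAll g q q∉g j)
                         (Finₚ.punchIn-mono-≤ q _ _ le))
  (λ le → Finₚ.punchIn-cancel-≤ q _ _
            (subst₂ Fin._≤_ (sym (punchIn-punchOutAll g q q∉g i)) (sym (punchIn-punchOutAll g q q∉g j)) le))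

-- By induction on t: the values below t are all hit by g, at indices where h is strictly smaller.
onto-sameOrder-≤ : ∀ {a b p} (g : Vec (Fin a) p) (h : Vec (Fin b) p) → Onto g → SameOrder g h →
                   ∀ t j → toℕ (lookup g j) ≡ t → t ≤ toℕ (lookup h j)
onto-sameOrder-≤ g h onto g∼h zero    j _    = z≤n
onto-sameOrder-≤ {a} g h onto g∼h (suc t) j gj≡1+t =
  ℕₚ.≤-trans (s≤s (onto-sameOrder-≤ g h onto g∼h t i gi≡t)) hi<hj
  where
    t<a : t < a
    t<a = ℕₚ.≤-trans (ℕₚ.≤-reflexive (sym gj≡1+t)) (ℕₚ.<⇒≤ (Finₚ.toℕ<n (lookup g j)))
    i = proj₁ (onto (fromℕ< t<a))
    gi≡t : toℕ (lookup g i) ≡ t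
    gi≡t = trans (cong toℕ (proj₂ (onto (fromℕ< t<a)))) (Finₚ.toℕ-fromℕ< t<a)
    gj≰gi : ¬ (lookup g j Fin.≤ lookup g i)
    gj≰gi le = ℕₚ.<-irrefl refl (ℕₚ.≤-trans (ℕₚ.≤-reflexive (sym gj≡1+t)) (ℕₚ.≤-trans le (ℕₚ.≤-reflexive gi≡t)))
    hi<hj : toℕ (lookup h i) < toℕ (lookup h j)
    hi<hj = ℕₚ.≰⇒> (gj≰gi ∘ Equivalence.from (≤⇔≤ g∼h j i))

onto-sameOrder-width : ∀ {a b p} (g : Vec (Fin a) p) (h : Vec (Fin b) p) → Onto g → SameOrder g h → a ≤ b
onto-sameOrder-width {zero}  g h onto g∼h = z≤n
onto-sameOrder-width {suc a} g h onto g∼h =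
  ℕₚ.≤-trans (s≤s (onto-sameOrder-≤ g h onto g∼h a j gj≡a)) (Finₚ.toℕ<n (lookup h j))
  where
    j = proj₁ (onto (Fin.fromℕ a))
    gj≡a : toℕ (lookup g j) ≡ a
    gj≡a = trans (cong toℕ (proj₂ (onto (Fin.fromℕ a)))) (Finₚ.toℕ-fromℕ a)

record OrderPattern {N p} (x : Vec (Fin N) p) : Set where
  field
    width           : ℕ
    shape           : Vec (Fin width) p
    shape-onto      : Onto shape
    shape-sameOrder : SameOrder shape x

orderPattern : ∀ {N p} (x : Vec (Fin N) p) → OrderPattern x
orderPattern {zero} x with onto-or-gap x
... | inj₁ onto   = record { shape = x ; shape-onto = onto ; shape-sameOrder = sameOrder-refl x }
... | inj₂ (() , _)
orderPattern {suc N} x with onto-or-gap x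
... | inj₁ onto = record { shape = x ; shape-onto = onto ; shape-sameOrder = sameOrder-refl x }
... | inj₂ (q , q∉x) = record
  { OrderPattern P
  ; shape-sameOrder = sameOrder-trans (OrderPattern.shape-sameOrder P) (punchOutAll-sameOrder x q q∉x) }
  where P = orderPattern (punchOutAll x q q∉x)

module Weightings {A : Set} {plus times : Op₂ A} {negate : Op₁ A} {zero′ one′ : A}
                  (isCommutativeRing : IsCommutativeRing _≡_ plus times negate zero′ one′) where

  open Summation isCommutativeRing

  record Weighting (n K : ℕ) : Set where
    field
      weight        : List (Fin n) → A
      weight-[]     : weight [] ≡ 1#
      weight-insert : ∀ b q → q ≤ length b → suc (length b) ≤ K →
                      ∑ (allFinL n) (λ v → weight (insertAtℕ b q v)) ≡ weight b
      weight-dup    : ∀ l → HasDup l → weight l ≡ 0#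

  module Marginals {n K : ℕ} (w : Weighting n K) where
    open Weighting w

    marginal : ∀ m {p} → Vec (Fin m) p → Vec (Fin n) p → A
    marginal m g a = ∑ (allTuples n m) (λ c → weight (toList c) * 𝟙 (sel c g ≟ᵥ a))

    ∑-weight : ∀ m → m ≤ K → ∑ (allTuples n m) (weight ∘ toList) ≡ 1#
    ∑-weight zero    _   = trans (+-identityʳ _) weight-[]
    ∑-weight (suc m) m<K = begin
      ∑ (allTuples n (suc m)) (weight ∘ toList)
        ≡⟨ ∑-allTuples-suc n m _ ⟩
      ∑ (allFinL n) (λ v → ∑ (allTuples n m) (λ e → weight (insertAtℕ (toList e) 0 v)))
        ≡⟨ ∑-comm (allFinL n) (allTuples n m) _ ⟩
      ∑ (allTuples n m) (λ e → ∑ (allFinL n) (λ v → weight (insertAtℕ (toList e) 0 v)))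
        ≡⟨ ∑-cong (allTuples n m) (λ e → weight-insert (toList e) 0 z≤n (length<K e)) ⟩
      ∑ (allTuples n m) (weight ∘ toList)
        ≡⟨ ∑-weight m (ℕₚ.<⇒≤ m<K) ⟩
      1# ∎
      where
        open ≡-Reasoning
        length<K : (e : Vec (Fin n) m) → suc (length (toList e)) ≤ K
        length<K e = subst (λ l → suc l ≤ K) (sym (Vecₚ.length-toList e)) m<K

    -- Summing out an unused coordinate is exactly the insertion law of the weighting.
    marginal-punchIn : ∀ m {p} (g : Vec (Fin m) p) q a → suc m ≤ K →
                       marginal (suc m) (Vec.map (punchIn q) g) a ≡ marginal m g a
    marginal-punchIn m g q a m<K = begin
      marginal (suc m) (Vec.map (punchIn q) g) a
        ≡⟨ ∑-allTuples-insertAt n m q _ ⟩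
      ∑ (allFinL n) (λ v → ∑ (allTuples n m) (λ e →
          weight (toList (Vec.insertAt e q v)) * 𝟙 (sel (Vec.insertAt e q v) (Vec.map (punchIn q) g) ≟ᵥ a)))
        ≡⟨ ∑-cong (allFinL n) (λ v → ∑-cong (allTuples n m) (λ e →
             cong₂ (λ u s → weight u * 𝟙 (s ≟ᵥ a)) (toList-insertAt e q v) (sel-insertAt-punchIn e q v g))) ⟩
      ∑ (allFinL n) (λ v → ∑ (allTuples n m) (λ e → weight (insertAtℕ (toList e) (toℕ q) v) * 𝟙 (sel e g ≟ᵥ a)))
        ≡⟨ ∑-comm (allFinL n) (allTuples n m) _ ⟩
      ∑ (allTuples n m) (λ e → ∑ (allFinL n) (λ v → weight (insertAtℕ (toList e) (toℕ q) v) * 𝟙 (sel e g ≟ᵥ a)))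
        ≡⟨ ∑-cong (allTuples n m) (λ e → trans (∑-*ʳ (allFinL n) _ _)
             (cong (_* 𝟙 (sel e g ≟ᵥ a)) (weight-insert (toList e) (toℕ q) (q≤length e) (length<K e)))) ⟩
      marginal m g a ∎
      where
        open ≡-Reasoning
        q≤length : (e : Vec (Fin n) m) → toℕ q ≤ length (toList e)
        q≤length e = subst (toℕ q ≤_) (sym (Vecₚ.length-toList e)) (Finₚ.toℕ≤pred[n] q)
        length<K : (e : Vec (Fin n) m) → suc (length (toList e)) ≤ K
        length<K e = subst (λ l → suc l ≤ K) (sym (Vecₚ.length-toList e)) m<K

    marginal-onto : ∀ {m₁ m₂ p} (g₁ : Vec (Fin m₁) p) (g₂ : Vec (Fin m₂) p) →
                    Onto g₁ → Onto g₂ → SameOrder g₁ g₂ → ∀ a → marginal m₁ g₁ a ≡ marginal m₂ g₂ a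
    marginal-onto {m₁} {m₂} g₁ g₂ onto₁ onto₂ g₁∼g₂ a = lemma m₁≡m₂ g₁≗g₂
      where
        m₁≡m₂ : m₁ ≡ m₂
        m₁≡m₂ = ℕₚ.≤-antisym (onto-sameOrder-width g₁ g₂ onto₁ g₁∼g₂)
                             (onto-sameOrder-width g₂ g₁ onto₂ (sameOrder-sym g₁∼g₂))
        g₁≗g₂ : ∀ j → toℕ (lookup g₁ j) ≡ toℕ (lookup g₂ j)
        g₁≗g₂ j = ℕₚ.≤-antisym (onto-sameOrder-≤ g₁ g₂ onto₁ g₁∼g₂ _ j refl)
                               (onto-sameOrder-≤ g₂ g₁ onto₂ (sameOrder-sym g₁∼g₂) _ j refl)
        lemma : m₁ ≡ m₂ → (∀ j → toℕ (lookup g₁ j) ≡ toℕ (lookup g₂ j)) → marginal m₁ g₁ a ≡ marginal m₂ g₂ a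
        lemma refl g₁≗g₂ = cong (λ g → marginal m₁ g a) (lookup-extensional (Finₚ.toℕ-injective ∘ g₁≗g₂))

    marginal-sameOrder : ∀ m₁ m₂ {p} (g₁ : Vec (Fin m₁) p) (g₂ : Vec (Fin m₂) p) → m₁ ≤ K → m₂ ≤ K →
                         SameOrder g₁ g₂ → ∀ a → marginal m₁ g₁ a ≡ marginal m₂ g₂ a
    marginal-sameOrder m₁ m₂ g₁ g₂ m₁≤K m₂≤K g₁∼g₂ a with onto-or-gap g₁
    marginal-sameOrder zero    m₂ g₁ g₂ m₁≤K m₂≤K g₁∼g₂ a | inj₂ (() , _)
    marginal-sameOrder (suc m) m₂ g₁ g₂ m₁≤K m₂≤K g₁∼g₂ a | inj₂ (q , q∉g₁) = begin
      marginal (suc m) g₁ a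
        ≡⟨ cong (λ g → marginal (suc m) g a) (map-punchIn-punchOutAll g₁ q q∉g₁) ⟨
      marginal (suc m) (Vec.map (punchIn q) g₁′) a
        ≡⟨ marginal-punchIn m g₁′ q a m₁≤K ⟩
      marginal m g₁′ a
        ≡⟨ marginal-sameOrder m m₂ g₁′ g₂ (ℕₚ.<⇒≤ m₁≤K) m₂≤K
             (sameOrder-trans (punchOutAll-sameOrder g₁ q q∉g₁) g₁∼g₂) a ⟩
      marginal m₂ g₂ a ∎
      where
        open ≡-Reasoning
        g₁′ = punchOutAll g₁ q q∉g₁
    ... | inj₁ onto₁ with onto-or-gap g₂
    marginal-sameOrder m₁ zero    g₁ g₂ m₁≤K m₂≤K g₁∼g₂ a | inj₁ onto₁ | inj₂ (() , _)
    marginal-sameOrder m₁ (suc m) g₁ g₂ m₁≤K m₂≤K g₁∼g₂ a | inj₁ onto₁ | inj₂ (q , q∉g₂) = begin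
      marginal m₁ g₁ a
        ≡⟨ marginal-sameOrder m₁ m g₁ g₂′ m₁≤K (ℕₚ.<⇒≤ m₂≤K)
             (sameOrder-trans g₁∼g₂ (sameOrder-sym (punchOutAll-sameOrder g₂ q q∉g₂))) a ⟩
      marginal m g₂′ a
        ≡⟨ marginal-punchIn m g₂′ q a m₂≤K ⟨
      marginal (suc m) (Vec.map (punchIn q) g₂′) a
        ≡⟨ cong (λ g → marginal (suc m) g a) (map-punchIn-punchOutAll g₂ q q∉g₂) ⟩
      marginal (suc m) g₂ a ∎
      where
        open ≡-Reasoning
        g₂′ = punchOutAll g₂ q q∉g₂
    ... | inj₁ onto₂ = marginal-onto g₁ g₂ onto₁ onto₂ g₁∼g₂ a

    ∑-marginal : ∀ m {p} (g : Vec (Fin m) p) (h : Vec (Fin n) p → A) →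
                 ∑ (allTuples n p) (λ a → h a * marginal m g a) ≡ ∑ (allTuples n m) (λ c → weight (toList c) * h (sel c g))
    ∑-marginal m {p} g h = begin
      ∑ (allTuples n p) (λ a → h a * marginal m g a)
        ≡⟨ ∑-cong (allTuples n p) (λ a → sym (∑-*ˡ (allTuples n m) (h a) _)) ⟩
      ∑ (allTuples n p) (λ a → ∑ (allTuples n m) (λ c → h a * (weight (toList c) * 𝟙 (sel c g ≟ᵥ a))))
        ≡⟨ ∑-comm (allTuples n p) (allTuples n m) _ ⟩
      ∑ (allTuples n m) (λ c → ∑ (allTuples n p) (λ a → h a * (weight (toList c) * 𝟙 (sel c g ≟ᵥ a))))
        ≡⟨ ∑-cong (allTuples n m) (λ c → trans (∑-cong (allTuples n p) (λ a → rearrange (h a) (weight (toList c)) _))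
             (trans (∑-*ˡ (allTuples n p) _ _) (cong (weight (toList c) *_) (∑-allTuples-point n p (sel c g) h)))) ⟩
      ∑ (allTuples n m) (λ c → weight (toList c) * h (sel c g)) ∎
      where
        open ≡-Reasoning
        rearrange : ∀ u v w → u * (v * w) ≡ v * (w * u)
        rearrange u v w = trans (*-comm u (v * w)) (*-assoc v w u)

  module Solution {n k : ℕ} (w : Weighting n k) (2≤k : 2 ≤ k) (X : Digraph) (loopless : Loopless X) where
    open Weighting w
    open Marginals w
    open OrderPattern

    patternMarginal : ∀ {p} → Tuple X p → Vec (Fin n) p → A
    patternMarginal x = marginal (width P) (shape P)
      where P = orderPattern x

    width≤k : ∀ {p} (x : Tuple X p) → p ≤ k → width (orderPattern x) ≤ k
    width≤k x p≤k = ℕₚ.≤-trans (onto⇒≤ (shape P) (shape-onto P)) p≤k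
      where P = orderPattern x

    patternMarginal-sameOrder : ∀ {p} (x : Tuple X p) → p ≤ k → ∀ {m} (g : Vec (Fin m) p) → m ≤ k →
                                SameOrder g x → ∀ a → marginal m g a ≡ patternMarginal x a
    patternMarginal-sameOrder x p≤k g m≤k g∼x = marginal-sameOrder _ _ g (shape P) m≤k (width≤k x p≤k)
                                                  (sameOrder-trans g∼x (sameOrder-sym (shape-sameOrder P)))
      where P = orderPattern x

    eq1 : ∀ x → ∑ (allTuples n k) (patternMarginal x) ≡ 1#
    eq1 x = begin
      ∑ (allTuples n k) (patternMarginal x)
        ≡⟨ ∑-cong (allTuples n k) (λ a → sym (*-identityˡ _)) ⟩
      ∑ (allTuples n k) (λ a → 1# * patternMarginal x a)
        ≡⟨ ∑-marginal (width P) (shape P) (λ _ → 1#) ⟩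
      ∑ (allTuples n (width P)) (λ c → weight (toList c) * 1#)
        ≡⟨ ∑-cong (allTuples n (width P)) (λ c → *-identityʳ _) ⟩
      ∑ (allTuples n (width P)) (weight ∘ toList)
        ≡⟨ ∑-weight (width P) (width≤k x ℕₚ.≤-refl) ⟩
      1# ∎
      where
        open ≡-Reasoning
        P = orderPattern x

    eq2 : ∀ x a (i : Vec (Fin k) k) →
          ∑ (filter (sel≡? i a) (allTuples n k)) (patternMarginal x) ≡ patternMarginal (sel x i) a
    eq2 x a i = begin
      ∑ (filter (sel≡? i a) (allTuples n k)) (patternMarginal x)
        ≡⟨ ∑-filter (sel≡? i a) (allTuples n k) _ ⟩
      ∑ (allTuples n k) (λ â → 𝟙 (sel â i ≟ᵥ a) * patternMarginal x â)
        ≡⟨ ∑-marginal (width P) (shape P) _ ⟩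
      ∑ (allTuples n (width P)) (λ c → weight (toList c) * 𝟙 (sel (sel c (shape P)) i ≟ᵥ a))
        ≡⟨ ∑-cong (allTuples n (width P)) (λ c → cong (λ t → weight (toList c) * 𝟙 (t ≟ᵥ a)) (sel-sel c (shape P) i)) ⟩
      marginal (width P) (sel (shape P) i) a
        ≡⟨ patternMarginal-sameOrder (sel x i) ℕₚ.≤-refl (sel (shape P) i) (width≤k x ℕₚ.≤-refl)
                                     (sameOrder-sel i (shape-sameOrder P)) a ⟩
      patternMarginal (sel x i) a ∎
      where
        open ≡-Reasoning
        P = orderPattern x

    nonEdge⇒≡ : ∀ (b : Vec (Fin n) 2) → ¬ IsEdge (K n) b → lookup b zero ≡ lookup b (suc zero)
    nonEdge⇒≡ b ¬edge with lookup b zero Finₚ.≟ lookup b (suc zero)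
    ... | yes eq = eq
    ... | no _   = ⊥-elim (¬edge refl)

    -- An edge of the loopless X has distinct ends, so its pattern is injective and c restricted
    -- to a non-edge of K n must repeat a vertex.
    weight-nonEdge : ∀ (y : Tuple X 2) → IsEdge X y → ∀ (c : Vec (Fin n) (width (orderPattern y))) →
                     ¬ IsEdge (K n) (sel c (shape (orderPattern y))) → weight (toList c) ≡ 0#
    weight-nonEdge y y∈X c ¬edge = weight-dup (toList c) (lookup-repeat⇒HasDup c g₀≢g₁ c-repeat)
      where
        P = orderPattern y
        g = shape P
        y₀≢y₁ : lookup y zero ≢ lookup y (suc zero)
        y₀≢y₁ eq = case (trans (sym y∈X) (trans (cong (λ z → edge X z (lookup y (suc zero))) eq) (loopless _)))
          where case : true ≢ false
                case ()
        g₀≢g₁ : lookup g zero ≢ lookup g (suc zero)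
        g₀≢g₁ = y₀≢y₁ ∘ sameOrder⇒≺ (shape-sameOrder P) zero (suc zero)
        c-repeat : lookup c (lookup g zero) ≡ lookup c (lookup g (suc zero))
        c-repeat = trans (sym (lookup-sel c g zero)) (trans (nonEdge⇒≡ (sel c g) ¬edge) (lookup-sel c g (suc zero)))

    eq3 : ∀ y → IsEdge X y → ∀ a (i : Vec (Fin 2) k) →
          ∑ (filter (λ b → isEdge? (K n) b ×-dec sel≡? i a b) (allTuples n 2)) (patternMarginal y)
            ≡ patternMarginal (sel y i) a
    eq3 y y∈X a i = begin
      ∑ (filter (λ b → isEdge? (K n) b ×-dec sel≡? i a b) (allTuples n 2)) (patternMarginal y)
        ≡⟨ ∑-filter (λ b → isEdge? (K n) b ×-dec sel≡? i a b) (allTuples n 2) _ ⟩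
      ∑ (allTuples n 2) (λ b → 𝟙 (isEdge? (K n) b ×-dec (sel b i ≟ᵥ a)) * patternMarginal y b)
        ≡⟨ ∑-marginal (width P) (shape P) _ ⟩
      ∑ (allTuples n (width P)) (λ c → weight (toList c) * 𝟙 (isEdge? (K n) (sel c (shape P)) ×-dec (sel (sel c (shape P)) i ≟ᵥ a)))
        ≡⟨ ∑-cong (allTuples n (width P)) (λ c → trans (drop-edge c (sel (sel c (shape P)) i ≟ᵥ a))
             (cong (λ t → weight (toList c) * 𝟙 (t ≟ᵥ a)) (sel-sel c (shape P) i))) ⟩
      marginal (width P) (sel (shape P) i) a
        ≡⟨ patternMarginal-sameOrder (sel y i) ℕₚ.≤-refl (sel (shape P) i) (width≤k y 2≤k)
                                     (sameOrder-sel i (shape-sameOrder P)) a ⟩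
      patternMarginal (sel y i) a ∎
      where
        open ≡-Reasoning
        P = orderPattern y
        drop-edge : ∀ c {Q : Set} (q : Dec Q) →
                    weight (toList c) * 𝟙 (isEdge? (K n) (sel c (shape P)) ×-dec q) ≡ weight (toList c) * 𝟙 q
        drop-edge c q with isEdge? (K n) (sel c (shape P))
        ... | yes edge = cong (weight (toList c) *_) (𝟙-cong (yes edge ×-dec q) q proj₂ (edge ,_))
        ... | no ¬edge = trans (cong (_* _) w≡0) (trans (zeroˡ _) (sym (trans (cong (_* _) w≡0) (zeroˡ _))))
          where w≡0 = weight-nonEdge y y∈X c ¬edge

    patternMarginal-≺ : ∀ {p} (x : Tuple X p) a → ¬ (x ≺ a) → patternMarginal x a ≡ 0#
    patternMarginal-≺ x a x⊀a = ∑-zero (allTuples n (width P)) λ c →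
      trans (cong (weight (toList c) *_) (𝟙-no (sel c (shape P) ≟ᵥ a) (x⊀a ∘ x≺sel c))) (zeroʳ _)
      where
        P = orderPattern x
        x≺sel : ∀ c → sel c (shape P) ≡ a → x ≺ a
        x≺sel c refl i j xᵢ≡xⱼ = begin
          lookup (sel c (shape P)) i   ≡⟨ lookup-sel c (shape P) i ⟩
          lookup c (lookup (shape P) i) ≡⟨ cong (lookup c) (sameOrder⇒≺ (sameOrder-sym (shape-sameOrder P)) i j xᵢ≡xⱼ) ⟩
          lookup c (lookup (shape P) j) ≡⟨ lookup-sel c (shape P) j ⟨
          lookup (sel c (shape P)) j   ∎
          where open ≡-Reasoning

    solves : Solves A _+_ 0# 1# k X (K n) patternMarginal patternMarginal
    solves = record
      { eq1 = eq1
      ; eq2 = eq2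
      ; eq3 = eq3
      ; eq4 = patternMarginal-≺
      ; eq5 = λ y b _ _ → patternMarginal-≺ y b
      }

triangular : ℕ → ℕ
triangular zero    = zero
triangular (suc m) = suc m ℕ.+ triangular m

triangular-mono : ∀ {i j} → i ≤ j → triangular i ≤ triangular j
triangular-mono {zero}  _         = z≤n
triangular-mono {suc i} (s≤s i≤j) = ℕₚ.+-mono-≤ (s≤s i≤j) (triangular-mono i≤j)

length-++-∷ : ∀ {B : Set} (b : List B) x (a : List B) → length (b ++ [ x ]) ℕ.+ length a ≡ length b ℕ.+ suc (length a)
length-++-∷ b x a = trans (cong (ℕ._+ length a) (Listₚ.length-++ b)) (ℕₚ.+-assoc (length b) 1 (length a))

insertAtℕ-++ : ∀ {B : Set} (b : List B) q x v → q ≤ length b → insertAtℕ b q v ++ [ x ] ≡ insertAtℕ (b ++ [ x ]) q v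
insertAtℕ-++ b       zero    x v _         = refl
insertAtℕ-++ (y ∷ b) (suc q) x v (s≤s q≤b) = cong (y ∷_) (insertAtℕ-++ b q x v q≤b)

insertAtℕ-length : ∀ {B : Set} (b : List B) v → insertAtℕ b (length b) v ≡ b ++ [ v ]
insertAtℕ-length []      v = refl
insertAtℕ-length (y ∷ b) v = cong (y ∷_) (insertAtℕ-length b v)

module MarkerWeights {A : Set} {plus times : Op₂ A} {negate : Op₁ A} {zero′ one′ : A}
                     (isCommutativeRing : IsCommutativeRing _≡_ plus times negate zero′ one′) (n : ℕ) where

  open Summation isCommutativeRing
  open Weightings isCommutativeRing using (Weighting)

  -- markedSum low F o b a is the sum, over the sets S of positions i of a carrying the marker
  -- value F + o + i, of (-1)^|S| * low (b ++ (a with S removed)).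
  markedSum : (List (Fin n) → A) → ℕ → ℕ → List (Fin n) → List (Fin n) → A
  markedSum low F o b []      = low b
  markedSum low F o b (x ∷ a) = markedSum low F (suc o) (b ++ [ x ]) a - 𝟙 (toℕ x ≟ F ℕ.+ o) * markedSum low F (suc o) b a

  mutual
    weightUpTo : ℕ → List (Fin n) → A
    weightUpTo zero    []      = 1#
    weightUpTo zero    (_ ∷ _) = 0#
    weightUpTo (suc M) l       = weightUpToSuc M l (length l ≤? M) (length l ≟ suc M)

    weightUpToSuc : ∀ M (l : List (Fin n)) → Dec (length l ≤ M) → Dec (length l ≡ suc M) → A
    weightUpToSuc M l (yes _) _       = weightUpTo M l
    weightUpToSuc M l (no _)  (yes _) = - markedSum (weightUpTo M) (triangular M) 0 [] l
    weightUpToSuc M l (no _)  (no _)  = 0#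

  markerWeight : List (Fin n) → A
  markerWeight l = weightUpTo (length l) l

  markerWeight-top : ∀ M l → length l ≡ suc M → markerWeight l ≡ - markedSum (weightUpTo M) (triangular M) 0 [] l
  markerWeight-top M l l≡1+M rewrite l≡1+M with length l ≤? M
  ... | yes l≤M = ⊥-elim (ℕₚ.<-irrefl refl (subst (_≤ M) l≡1+M l≤M))
  ... | no _ with length l ≟ suc M
  ...   | yes _    = refl
  ...   | no l≢1+M = ⊥-elim (l≢1+M l≡1+M)

  weightUpTo-≤ : ∀ M l → length l ≤ M → weightUpTo M l ≡ markerWeight l
  weightUpTo-≤ zero    []  _   = refl
  weightUpTo-≤ (suc M) l   l≤1+M with length l ≤? M
  ... | yes l≤M = weightUpTo-≤ M l l≤M
  ... | no l≰M with length l ≟ suc M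
  ...   | yes l≡1+M = sym (markerWeight-top M l l≡1+M)
  ...   | no l≢1+M  = ⊥-elim (l≢1+M (ℕₚ.≤-antisym l≤1+M (ℕₚ.≰⇒> l≰M)))

  weightUpTo-> : ∀ M l → M < length l → weightUpTo M l ≡ 0#
  weightUpTo-> zero    (_ ∷ _) _   = refl
  weightUpTo-> (suc M) l       M<l with length l ≤? M
  ... | yes l≤M = ⊥-elim (ℕₚ.<-irrefl refl (ℕₚ.≤-trans M<l (ℕₚ.m≤n⇒m≤1+n l≤M)))
  ... | no _ with length l ≟ suc M
  ...   | yes l≡1+M = ⊥-elim (ℕₚ.<⇒≢ M<l (sym l≡1+M))
  ...   | no _      = refl

  ∑-toℕ-point : ∀ t → t < n → (c : A) → ∑ (allFinL n) (λ v → 𝟙 (toℕ v ≟ t) * c) ≡ c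
  ∑-toℕ-point t t<n c = trans (∑-cong (allFinL n) (λ v → cong (_* c) (𝟙-cong (toℕ v ≟ t) (u Finₚ.≟ v)
                                  (λ v≡t → Finₚ.toℕ-injective (trans (Finₚ.toℕ-fromℕ< t<n) (sym v≡t)))
                                  (λ u≡v → trans (cong toℕ (sym u≡v)) (Finₚ.toℕ-fromℕ< t<n)))))
                              (∑-allFin-point n u (u Finₚ.≟_) (λ _ → c))
    where u = fromℕ< t<n

  -- low is a weight truncated at length M, so inserting into a word of length M yields 0, not low c.
  module Insertion (low : List (Fin n) → A) (F M : ℕ)
    (low-insert : ∀ c q → q ≤ length c → length c ≤ M →
                  ∑ (allFinL n) (λ v → low (insertAtℕ c q v)) ≡ low c - 𝟙 (length c ≟ M) * low c)
    (F+M<n : F ℕ.+ M < n) where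

    σ = markedSum low F


    top : List (Fin n) → List (Fin n) → A
    top b a = 𝟙 (length b ℕ.+ length a ≟ M) * low (b ++ a)

    top-++-∷ : ∀ b x a → top (b ++ [ x ]) a ≡ top b (x ∷ a)
    top-++-∷ b x a = cong₂ (λ i l → i * low l)
      (𝟙-cong (length (b ++ [ x ]) ℕ.+ length a ≟ M) (length b ℕ.+ length (x ∷ a) ≟ M)
              (trans (sym (length-++-∷ b x a))) (trans (length-++-∷ b x a)))
      (Listₚ.++-assoc b [ x ] a)

    top-< : ∀ b a → length b ℕ.+ length a < M → top b a ≡ 0#
    top-< b a b+a<M = trans (cong (_* low (b ++ a)) (𝟙-no (length b ℕ.+ length a ≟ M) (ℕₚ.<⇒≢ b+a<M))) (zeroˡ _)

    ∑-markedSum-insertPrefix : ∀ a b q o → q ≤ length b → length b ℕ.+ length a ≤ M →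
      ∑ (allFinL n) (λ v → σ o (insertAtℕ b q v) a) ≡ σ o b a - top b a
    ∑-markedSum-insertPrefix [] b q o q≤b b≤M = begin
      ∑ (allFinL n) (λ v → low (insertAtℕ b q v))
        ≡⟨ low-insert b q q≤b (subst (_≤ M) (ℕₚ.+-identityʳ (length b)) b≤M) ⟩
      low b - 𝟙 (length b ≟ M) * low b
        ≡⟨ cong₂ (λ i l → low b - i * low l)
                 (𝟙-cong (length b ≟ M) (length b ℕ.+ 0 ≟ M) (trans (ℕₚ.+-identityʳ _)) (trans (sym (ℕₚ.+-identityʳ _))))
                 (sym (Listₚ.++-identityʳ b)) ⟩
      low b - 𝟙 (length b ℕ.+ 0 ≟ M) * low (b ++ []) ∎
      where open ≡-Reasoning
    ∑-markedSum-insertPrefix (x ∷ a) b q o q≤b b+xa≤M = begin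
      ∑ (allFinL n) (λ v → σ (suc o) (insertAtℕ b q v ++ [ x ]) a - marker * σ (suc o) (insertAtℕ b q v) a)
        ≡⟨ ∑-sub-*ˡ (allFinL n) marker _ _ ⟩
      ∑ (allFinL n) (λ v → σ (suc o) (insertAtℕ b q v ++ [ x ]) a) - marker * ∑ (allFinL n) (λ v → σ (suc o) (insertAtℕ b q v) a)
        ≡⟨ cong (λ s → s - marker * ∑ (allFinL n) (λ v → σ (suc o) (insertAtℕ b q v) a))
                (∑-cong (allFinL n) (λ v → cong (λ l → σ (suc o) l a) (insertAtℕ-++ b q x v q≤b))) ⟩
      ∑ (allFinL n) (λ v → σ (suc o) (insertAtℕ (b ++ [ x ]) q v) a) - marker * ∑ (allFinL n) (λ v → σ (suc o) (insertAtℕ b q v) a)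
        ≡⟨ cong₂ (λ s t → s - marker * t)
                 (∑-markedSum-insertPrefix a (b ++ [ x ]) q (suc o) q≤bx (subst (_≤ M) (sym (length-++-∷ b x a)) b+xa≤M))
                 (trans (∑-markedSum-insertPrefix a b q (suc o) q≤b (ℕₚ.<⇒≤ b+a<M))
                        (trans (cong (λ t → σ (suc o) b a - t) (top-< b a b+a<M)) (x-0≡x _))) ⟩
      σ (suc o) (b ++ [ x ]) a - top (b ++ [ x ]) a - marker * σ (suc o) b a
        ≡⟨ xy∙z≈xz∙y _ (- top (b ++ [ x ]) a) _ ⟩
      σ o b (x ∷ a) - top (b ++ [ x ]) a
        ≡⟨ cong (λ t → σ o b (x ∷ a) - t) (top-++-∷ b x a) ⟩
      σ o b (x ∷ a) - top b (x ∷ a) ∎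
      where
        open ≡-Reasoning
        marker = 𝟙 (toℕ x ≟ F ℕ.+ o)
        q≤bx : q ≤ length (b ++ [ x ])
        q≤bx = ℕₚ.≤-trans q≤b (subst (length b ≤_) (sym (Listₚ.length-++ b)) (ℕₚ.m≤m+n (length b) 1))
        b+a<M : length b ℕ.+ length a < M
        b+a<M = subst (_≤ M) (ℕₚ.+-suc (length b) (length a)) b+xa≤M

    ∑-markedSum-insertSuffix : ∀ a b p o → p ≤ length a → length b ℕ.+ length a ≤ M → o ℕ.+ length a ≤ M →
      ∑ (allFinL n) (λ v → σ o b (insertAtℕ a p v)) ≡ - top b a
    ∑-markedSum-insertSuffix a b zero o _ b+a≤M o+a≤M = begin
      ∑ (allFinL n) (λ v → σ (suc o) (b ++ [ v ]) a - 𝟙 (toℕ v ≟ F ℕ.+ o) * σ (suc o) b a)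
        ≡⟨ ∑-sub (allFinL n) _ _ ⟩
      ∑ (allFinL n) (λ v → σ (suc o) (b ++ [ v ]) a) - ∑ (allFinL n) (λ v → 𝟙 (toℕ v ≟ F ℕ.+ o) * σ (suc o) b a)
        ≡⟨ cong₂ _-_ (trans (∑-cong (allFinL n) (λ v → cong (λ l → σ (suc o) l a) (sym (insertAtℕ-length b v))))
                            (∑-markedSum-insertPrefix a b (length b) (suc o) ℕₚ.≤-refl b+a≤M))
                     (∑-toℕ-point (F ℕ.+ o) F+o<n _) ⟩
      σ (suc o) b a - top b a - σ (suc o) b a
        ≡⟨ xyx⁻¹≈y _ (- top b a) ⟩
      - top b a ∎
      where
        open ≡-Reasoning
        F+o<n : F ℕ.+ o < n
        F+o<n = ℕₚ.≤-trans (s≤s (ℕₚ.+-monoʳ-≤ F (ℕₚ.≤-trans (ℕₚ.m≤m+n o (length a)) o+a≤M))) F+M<n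
    ∑-markedSum-insertSuffix (x ∷ a) b (suc p) o (s≤s p≤a) b+xa≤M o+xa≤M = begin
      ∑ (allFinL n) (λ v → σ (suc o) (b ++ [ x ]) (insertAtℕ a p v) - marker * σ (suc o) b (insertAtℕ a p v))
        ≡⟨ ∑-sub-*ˡ (allFinL n) marker _ _ ⟩
      ∑ (allFinL n) (λ v → σ (suc o) (b ++ [ x ]) (insertAtℕ a p v)) - marker * ∑ (allFinL n) (λ v → σ (suc o) b (insertAtℕ a p v))
        ≡⟨ cong₂ (λ s t → s - marker * t)
                 (∑-markedSum-insertSuffix a (b ++ [ x ]) p (suc o) p≤a (subst (_≤ M) (sym (length-++-∷ b x a)) b+xa≤M) 1+o+a≤M)
                 (∑-markedSum-insertSuffix a b p (suc o) p≤a (ℕₚ.<⇒≤ b+a<M) 1+o+a≤M) ⟩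
      - top (b ++ [ x ]) a - marker * - top b a
        ≡⟨ cong (λ t → - top (b ++ [ x ]) a - marker * t) (trans (cong -_ (top-< b a b+a<M)) -0#≈0#) ⟩
      - top (b ++ [ x ]) a - marker * 0#
        ≡⟨ trans (cong (λ t → - top (b ++ [ x ]) a - t) (zeroʳ marker)) (x-0≡x _) ⟩
      - top (b ++ [ x ]) a
        ≡⟨ cong -_ (top-++-∷ b x a) ⟩
      - top b (x ∷ a) ∎
      where
        open ≡-Reasoning
        marker = 𝟙 (toℕ x ≟ F ℕ.+ o)
        b+a<M : length b ℕ.+ length a < M
        b+a<M = subst (_≤ M) (ℕₚ.+-suc (length b) (length a)) b+xa≤M
        1+o+a≤M : suc o ℕ.+ length a ≤ M
        1+o+a≤M = subst (_≤ M) (ℕₚ.+-suc o (length a)) o+xa≤M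

  weightUpTo-insert : ∀ M → (∀ c q → q ≤ length c → length c < M →
                              ∑ (allFinL n) (λ v → markerWeight (insertAtℕ c q v)) ≡ markerWeight c) →
                      ∀ c q → q ≤ length c → length c ≤ M →
                      ∑ (allFinL n) (λ v → weightUpTo M (insertAtℕ c q v)) ≡ weightUpTo M c - 𝟙 (length c ≟ M) * weightUpTo M c
  weightUpTo-insert M IH c q q≤c c≤M with length c ≟ M
  ... | yes c≡M = begin
    ∑ (allFinL n) (λ v → weightUpTo M (insertAtℕ c q v))
      ≡⟨ ∑-zero (allFinL n) (λ v → weightUpTo-> M _ (subst (M <_) (sym (length-insertAtℕ c q v)) (s≤s (ℕₚ.≤-reflexive (sym c≡M))))) ⟩
    0#
      ≡⟨ -‿inverseʳ _ ⟨
    weightUpTo M c - weightUpTo M c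
      ≡⟨ cong (λ t → weightUpTo M c - t) (*-identityˡ _) ⟨
    weightUpTo M c - 1# * weightUpTo M c ∎
    where open ≡-Reasoning
  ... | no c≢M = begin
    ∑ (allFinL n) (λ v → weightUpTo M (insertAtℕ c q v))
      ≡⟨ ∑-cong (allFinL n) (λ v → weightUpTo-≤ M _ (subst (_≤ M) (sym (length-insertAtℕ c q v)) c<M)) ⟩
    ∑ (allFinL n) (λ v → markerWeight (insertAtℕ c q v))
      ≡⟨ IH c q q≤c c<M ⟩
    markerWeight c
      ≡⟨ weightUpTo-≤ M c c≤M ⟨
    weightUpTo M c
      ≡⟨ x-0≡x _ ⟨
    weightUpTo M c - 0#
      ≡⟨ cong (λ t → weightUpTo M c - t) (zeroˡ _) ⟨
    weightUpTo M c - 0# * weightUpTo M c ∎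
    where
      open ≡-Reasoning
      c<M = ℕₚ.≤∧≢⇒< c≤M c≢M

  markerWeight-insert : ∀ k → triangular k ≤ n → ∀ b q → q ≤ length b → suc (length b) ≤ k →
                        ∑ (allFinL n) (λ v → markerWeight (insertAtℕ b q v)) ≡ markerWeight b
  markerWeight-insert k T[k]≤n b q = below (length b) b q ℕₚ.≤-refl
    where
      step : ∀ b q → (∀ c q → q ≤ length c → length c < length b → ∑ (allFinL n) (λ v → markerWeight (insertAtℕ c q v)) ≡ markerWeight c) →
             q ≤ length b → suc (length b) ≤ k → ∑ (allFinL n) (λ v → markerWeight (insertAtℕ b q v)) ≡ markerWeight b
      step b q IH q≤b b<k = begin
        ∑ (allFinL n) (λ v → markerWeight (insertAtℕ b q v))
          ≡⟨ ∑-cong (allFinL n) (λ v → markerWeight-top M (insertAtℕ b q v) (length-insertAtℕ b q v)) ⟩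
        ∑ (allFinL n) (λ v → - markedSum (weightUpTo M) (triangular M) 0 [] (insertAtℕ b q v))
          ≡⟨ ∑-neg (allFinL n) _ ⟩
        - ∑ (allFinL n) (λ v → markedSum (weightUpTo M) (triangular M) 0 [] (insertAtℕ b q v))
          ≡⟨ cong -_ (Insertion.∑-markedSum-insertSuffix (weightUpTo M) (triangular M) M (weightUpTo-insert M IH) T[M]+M<n
                        b [] q 0 q≤b ℕₚ.≤-refl ℕₚ.≤-refl) ⟩
        - - (𝟙 (M ≟ M) * weightUpTo M b)
          ≡⟨ -‿involutive _ ⟩
        𝟙 (M ≟ M) * weightUpTo M b
          ≡⟨ cong₂ _*_ (𝟙-yes (M ≟ M) refl) (weightUpTo-≤ M b ℕₚ.≤-refl) ⟩
        1# * markerWeight b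
          ≡⟨ *-identityˡ _ ⟩
        markerWeight b ∎
        where
          open ≡-Reasoning
          M = length b
          T[M]+M<n : triangular M ℕ.+ M < n
          T[M]+M<n = subst (_≤ n) (cong suc (ℕₚ.+-comm M (triangular M))) (ℕₚ.≤-trans (triangular-mono b<k) T[k]≤n)
      below : ∀ N b q → length b ≤ N → q ≤ length b → suc (length b) ≤ k →
              ∑ (allFinL n) (λ v → markerWeight (insertAtℕ b q v)) ≡ markerWeight b
      below zero    b q b≤0   q≤b b<k = step b q (λ c _ _ c<b → ⊥-elim (ℕₚ.n≮0 (ℕₚ.≤-trans c<b b≤0))) q≤b b<k
      below (suc N) b q b≤1+N q≤b b<k = step b q IH q≤b b<k
        where IH = λ c q′ q′≤c c<b → below N c q′ (ℕₚ.≤-pred (ℕₚ.≤-trans c<b b≤1+N)) q′≤c (ℕₚ.≤-trans (s≤s (ℕₚ.<⇒≤ c<b)) b<k)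

  AnyAtLeast : ℕ → List (Fin n) → Set
  AnyAtLeast G = Any (λ z → G ≤ toℕ z)

  markedSum-∷≡0 : ∀ low F o b x a → markedSum low F (suc o) (b ++ [ x ]) a ≡ 0# →
                  𝟙 (toℕ x ≟ F ℕ.+ o) * markedSum low F (suc o) b a ≡ 0# → markedSum low F o b (x ∷ a) ≡ 0#
  markedSum-∷≡0 low F o b x a kept≡0 removed≡0 = begin
    markedSum low F (suc o) (b ++ [ x ]) a - 𝟙 (toℕ x ≟ F ℕ.+ o) * markedSum low F (suc o) b a
      ≡⟨ cong₂ _-_ kept≡0 removed≡0 ⟩
    0# - 0#
      ≡⟨ -‿inverseʳ 0# ⟩
    0# ∎
    where open ≡-Reasoning

  module Vanishing (low : List (Fin n) → A) (F : ℕ)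
    (low-large : ∀ c → AnyAtLeast F c → low c ≡ 0#) (low-dup : ∀ c → HasDup c → low c ≡ 0#) where

    σ = markedSum low F

    *0 : ∀ x {y} → y ≡ 0# → x * y ≡ 0#
    *0 x y≡0 = trans (cong (x *_) y≡0) (zeroʳ x)

    markedSum-largePrefix : ∀ a o b → AnyAtLeast F b → σ o b a ≡ 0#
    markedSum-largePrefix []      o b large = low-large b large
    markedSum-largePrefix (x ∷ a) o b large = markedSum-∷≡0 low F o b x a
      (markedSum-largePrefix a (suc o) (b ++ [ x ]) (Anyₚ.++⁺ˡ large))
      (*0 _ (markedSum-largePrefix a (suc o) b large))

    -- A value F + t with t < o in a can never be removed as a marker, so it survives into the prefix.
    markedSum-staleMarker : ∀ a o b → Any (λ z → ∃ λ t → t < o × toℕ z ≡ F ℕ.+ t) a → σ o b a ≡ 0#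
    markedSum-staleMarker (y ∷ a) o b (here (t , t<o , y≡F+t)) = markedSum-∷≡0 low F o b y a
      (markedSum-largePrefix a (suc o) (b ++ [ y ]) (Anyₚ.++⁺ʳ b (here (subst (F ≤_) (sym y≡F+t) (ℕₚ.m≤m+n F t)))))
      (trans (cong (_* σ (suc o) b a) (𝟙-no (toℕ y ≟ F ℕ.+ o)
                (λ y≡F+o → ℕₚ.<⇒≢ t<o (ℕₚ.+-cancelˡ-≡ F t o (trans (sym y≡F+t) y≡F+o)))))
             (zeroˡ _))
    markedSum-staleMarker (y ∷ a) o b (there stale) = markedSum-∷≡0 low F o b y a
      (markedSum-staleMarker a (suc o) (b ++ [ y ]) stale′)
      (*0 _ (markedSum-staleMarker a (suc o) b stale′))
      where stale′ = Any.map (λ { (t , t<o , eq) → t , ℕₚ.m<n⇒m<1+n t<o , eq }) stale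

    markedSum-dup : ∀ a o b → HasDup (b ++ a) → σ o b a ≡ 0#
    markedSum-dup []      o b dup = low-dup b (subst HasDup (Listₚ.++-identityʳ b) dup)
    markedSum-dup (x ∷ a) o b dup = markedSum-∷≡0 low F o b x a
      (markedSum-dup a (suc o) (b ++ [ x ]) (subst HasDup (sym (Listₚ.++-assoc b [ x ] a)) dup))
      removed≡0
      where
        removed≡0 : 𝟙 (toℕ x ≟ F ℕ.+ o) * σ (suc o) b a ≡ 0#
        removed≡0 with toℕ x ≟ F ℕ.+ o
        ... | no _ = zeroˡ _
        ... | yes x≡F+o with HasDup-++-∷ b x a dup
        ...   | inj₁ dup′       = *0 1# (markedSum-dup a (suc o) b dup′)
        ...   | inj₂ (inj₁ x∈b) = *0 1# (markedSum-largePrefix a (suc o) b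
                                          (lose x∈b (subst (F ≤_) (sym x≡F+o) (ℕₚ.m≤m+n F o))))
        ...   | inj₂ (inj₂ x∈a) = *0 1# (markedSum-staleMarker a (suc o) b (lose x∈a (o , ℕₚ.≤-refl , x≡F+o)))

    markedSum-large : ∀ G a o b → F ℕ.+ (o ℕ.+ length a) ≤ G → AnyAtLeast G (b ++ a) → σ o b a ≡ 0#
    markedSum-large G []      o b F+o≤G large =
      low-large b (Any.map (ℕₚ.≤-trans (ℕₚ.≤-trans (ℕₚ.m≤m+n F _) F+o≤G)) (subst (AnyAtLeast G) (Listₚ.++-identityʳ b) large))
    markedSum-large G (x ∷ a) o b F+o+xa≤G large = markedSum-∷≡0 low F o b x a
      (markedSum-large G a (suc o) (b ++ [ x ]) F+1+o+a≤G (subst (AnyAtLeast G) (sym (Listₚ.++-assoc b [ x ] a)) large))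
      removed≡0
      where
        F+1+o+a≤G : F ℕ.+ (suc o ℕ.+ length a) ≤ G
        F+1+o+a≤G = subst (λ j → F ℕ.+ j ≤ G) (ℕₚ.+-suc o (length a)) F+o+xa≤G
        F+o<G : F ℕ.+ o < G
        F+o<G = ℕₚ.≤-trans (ℕₚ.≤-reflexive (sym (ℕₚ.+-suc F o)))
                  (ℕₚ.≤-trans (ℕₚ.+-monoʳ-≤ F (s≤s (ℕₚ.m≤m+n o (length a)))) F+1+o+a≤G)
        removed≡0 : 𝟙 (toℕ x ≟ F ℕ.+ o) * σ (suc o) b a ≡ 0#
        removed≡0 with Anyₚ.++⁻ b large
        ... | inj₁ large-b      = *0 _ (markedSum-large G a (suc o) b F+1+o+a≤G (Anyₚ.++⁺ˡ large-b))
        ... | inj₂ (there large-a) = *0 _ (markedSum-large G a (suc o) b F+1+o+a≤G (Anyₚ.++⁺ʳ b large-a))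
        ... | inj₂ (here G≤x)   = trans (cong (_* σ (suc o) b a)
                                    (𝟙-no (toℕ x ≟ F ℕ.+ o) (λ x≡F+o → ℕₚ.<⇒≱ F+o<G (subst (G ≤_) x≡F+o G≤x))))
                                    (zeroˡ _)

  -- Entries ≥ triangular M lie above every marker value used at lengths ≤ M, which is what lets
  -- both vanishing properties pass from weightUpTo M to the words of length M + 1.
  markerWeight-vanishes : ∀ M l → length l ≤ M →
                          (HasDup l → markerWeight l ≡ 0#) × (AnyAtLeast (triangular (length l)) l → markerWeight l ≡ 0#)
  markerWeight-vanishes zero    []  _ = (λ ()) , (λ ())
  markerWeight-vanishes (suc M) l l≤1+M with length l ≤? M
  ... | yes l≤M = markerWeight-vanishes M l l≤M
  ... | no l≰M = (λ dup → trans (markerWeight-top M l l≡1+M) (-≡0 (V.markedSum-dup l 0 [] dup)))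
               , (λ large → trans (markerWeight-top M l l≡1+M)
                                  (-≡0 (V.markedSum-large (triangular (suc M)) l 0 [] bound
                                                          (subst (λ j → AnyAtLeast (triangular j) l) l≡1+M large))))
    where
      l≡1+M : length l ≡ suc M
      l≡1+M = ℕₚ.≤-antisym l≤1+M (ℕₚ.≰⇒> l≰M)
      bound : triangular M ℕ.+ (0 ℕ.+ length l) ≤ triangular (suc M)
      bound = ℕₚ.≤-reflexive (trans (cong (triangular M ℕ.+_) l≡1+M) (ℕₚ.+-comm (triangular M) (suc M)))
      -≡0 : ∀ {x} → x ≡ 0# → - x ≡ 0#
      -≡0 x≡0 = trans (cong -_ x≡0) -0#≈0#
      truncated : ∀ c → (length c ≤ M → markerWeight c ≡ 0#) → weightUpTo M c ≡ 0#
      truncated c vanish with length c ≤? M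
      ... | yes c≤M = trans (weightUpTo-≤ M c c≤M) (vanish c≤M)
      ... | no c≰M  = weightUpTo-> M c (ℕₚ.≰⇒> c≰M)
      module V = Vanishing (weightUpTo M) (triangular M)
        (λ c large → truncated c (λ c≤M → proj₂ (markerWeight-vanishes M c c≤M)
                                            (Any.map (ℕₚ.≤-trans (triangular-mono c≤M)) large)))
        (λ c dup → truncated c (λ c≤M → proj₁ (markerWeight-vanishes M c c≤M) dup))

  markerWeight-dup : ∀ l → HasDup l → markerWeight l ≡ 0#
  markerWeight-dup l = proj₁ (markerWeight-vanishes (length l) l ℕₚ.≤-refl)

  markerWeighting : ∀ k → triangular k ≤ n → Weighting n k
  markerWeighting k T[k]≤n = record
    { weight        = markerWeight
    ; weight-[]     = refl
    ; weight-insert = markerWeight-insert k T[k]≤n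
    ; weight-dup    = markerWeight-dup
    }

module UniformWeights (n : ℕ) where

  open Summation ℚₚ.+-*-isCommutativeRing
  open Weightings ℚₚ.+-*-isCommutativeRing using (Weighting)
  open DecMembership (Finₚ._≟_ {n}) using (_∈?_)

  fromℕ : ℕ → ℚ
  fromℕ zero    = 0ℚ
  fromℕ (suc j) = 1ℚ + fromℕ j

  fromℕ-+ : ∀ i j → fromℕ (i ℕ.+ j) ≡ fromℕ i + fromℕ j
  fromℕ-+ zero    j = sym (+-identityˡ (fromℕ j))
  fromℕ-+ (suc i) j = trans (cong (1ℚ +_) (fromℕ-+ i j)) (sym (+-assoc 1ℚ (fromℕ i) (fromℕ j)))

  fromℕ-∸ : ∀ m → m ≤ n → fromℕ n - fromℕ m ≡ fromℕ (n ∸ m)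
  fromℕ-∸ m m≤n = begin
    fromℕ n - fromℕ m                        ≡⟨ cong (λ j → fromℕ j - fromℕ m) (ℕₚ.m+[n∸m]≡n m≤n) ⟨
    fromℕ (m ℕ.+ (n ∸ m)) - fromℕ m  ≡⟨ cong (_- fromℕ m) (trans (fromℕ-+ m (n ∸ m)) (+-comm (fromℕ m) (fromℕ (n ∸ m)))) ⟩
    fromℕ (n ∸ m) + fromℕ m - fromℕ m        ≡⟨ +-assoc (fromℕ (n ∸ m)) (fromℕ m) (- fromℕ m) ⟩
    fromℕ (n ∸ m) + (fromℕ m - fromℕ m)      ≡⟨ cong (fromℕ (n ∸ m) +_) (-‿inverseʳ (fromℕ m)) ⟩
    fromℕ (n ∸ m) + 0ℚ                       ≡⟨ +-identityʳ (fromℕ (n ∸ m)) ⟩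
    fromℕ (n ∸ m)                            ∎
    where open ≡-Reasoning

  fromℕ-nonNeg : ∀ j → NonNegative (fromℕ j)
  fromℕ-nonNeg zero    = _
  fromℕ-nonNeg (suc j) = ℚₚ.nonNeg+nonNeg⇒nonNeg 1ℚ (fromℕ j) {{fromℕ-nonNeg j}}

  fromℕ-suc-pos : ∀ j → Positive (fromℕ (suc j))
  fromℕ-suc-pos j = ℚₚ.pos+nonNeg⇒pos 1ℚ (fromℕ j) {{fromℕ-nonNeg j}}

  ∑-1 : ∑ (allFinL n) (λ _ → 1ℚ) ≡ fromℕ n
  ∑-1 = go n
    where
      go : ∀ m → ∑ (allFinL m) (λ _ → 1ℚ) ≡ fromℕ m
      go zero    = refl
      go (suc m) = trans (∑-allFin-suc m (λ _ → 1ℚ)) (cong (1ℚ +_) (go m))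

  -- recip 0 = 0ℚ is a junk value; it is only reached through injectiveWeight m with m ≥ n.
  recip : ℕ → ℚ
  recip zero    = 0ℚ
  recip (suc j) = (1/ fromℕ (suc j)) {{ℚₚ.pos⇒nonZero (fromℕ (suc j)) {{fromℕ-suc-pos j}}}}

  recip-nonNeg : ∀ j → NonNegative (recip j)
  recip-nonNeg zero    = _
  recip-nonNeg (suc j) = ℚₚ.pos⇒nonNeg (recip (suc j)) {{ℚₚ.1/pos⇒pos (fromℕ (suc j)) {{fromℕ-suc-pos j}}}}

  -- injectiveWeight m = 1 / (n (n - 1) ⋯ (n - m + 1)), the probability of each injective word of length m.
  injectiveWeight : ℕ → ℚ
  injectiveWeight zero    = 1ℚ
  injectiveWeight (suc m) = injectiveWeight m * recip (n ∸ m)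

  injectiveWeight-nonNeg : ∀ m → NonNegative (injectiveWeight m)
  injectiveWeight-nonNeg zero    = _
  injectiveWeight-nonNeg (suc m) =
    ℚₚ.nonNeg*nonNeg⇒nonNeg (injectiveWeight m) {{injectiveWeight-nonNeg m}} (recip (n ∸ m)) {{recip-nonNeg (n ∸ m)}}

  injectiveWeight-pos : ∀ m → m ≤ n → Positive (injectiveWeight m)
  injectiveWeight-pos zero    _   = _
  injectiveWeight-pos (suc m) m<n with n ∸ m | ℕₚ.m>n⇒m∸n≢0 {n} {m} m<n
  ... | zero  | n∸m≢0 = ⊥-elim (n∸m≢0 refl)
  ... | suc j | _     = ℚₚ.pos*pos⇒pos (injectiveWeight m) {{injectiveWeight-pos m (ℕₚ.<⇒≤ m<n)}}
                                       (recip (suc j)) {{ℚₚ.1/pos⇒pos (fromℕ (suc j)) {{fromℕ-suc-pos j}}}}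

  injectiveWeight-suc : ∀ m → m < n → fromℕ (n ∸ m) * injectiveWeight (suc m) ≡ injectiveWeight m
  injectiveWeight-suc m m<n with n ∸ m | ℕₚ.m>n⇒m∸n≢0 {n} {m} m<n
  ... | zero  | n∸m≢0 = ⊥-elim (n∸m≢0 refl)
  ... | suc j | _     = begin
    fromℕ (suc j) * (injectiveWeight m * recip (suc j))  ≡⟨ cong (fromℕ (suc j) *_) (*-comm (injectiveWeight m) (recip (suc j))) ⟩
    fromℕ (suc j) * (recip (suc j) * injectiveWeight m)  ≡⟨ *-assoc (fromℕ (suc j)) (recip (suc j)) (injectiveWeight m) ⟨
    fromℕ (suc j) * recip (suc j) * injectiveWeight m    ≡⟨ cong (_* injectiveWeight m) inverse ⟩
    1ℚ * injectiveWeight m                               ≡⟨ *-identityˡ (injectiveWeight m) ⟩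
    injectiveWeight m                                    ∎
    where
      open ≡-Reasoning
      inverse : fromℕ (suc j) * recip (suc j) ≡ 1ℚ
      inverse = ℚₚ.*-inverseʳ (fromℕ (suc j)) {{ℚₚ.pos⇒nonZero (fromℕ (suc j)) {{fromℕ-suc-pos j}}}}

  hasDup? : (l : List (Fin n)) → Dec (HasDup l)
  hasDup? []      = no λ ()
  hasDup? (x ∷ l) with x ∈? l
  ... | yes x∈l = yes (here x∈l)
  ... | no x∉l with hasDup? l
  ...   | yes dup = yes (there dup)
  ...   | no ¬dup = no λ { (here x∈l) → x∉l x∈l ; (there dup) → ¬dup dup }

  uniformWeight′ : ∀ {l : List (Fin n)} → Dec (HasDup l) → ℚ
  uniformWeight′     (yes _) = 0ℚ
  uniformWeight′ {l} (no _)  = injectiveWeight (length l)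

  uniformWeight : List (Fin n) → ℚ
  uniformWeight l = uniformWeight′ (hasDup? l)

  uniformWeight-dup : ∀ l → HasDup l → uniformWeight l ≡ 0ℚ
  uniformWeight-dup l dup with hasDup? l
  ... | yes _   = refl
  ... | no ¬dup = ⊥-elim (¬dup dup)

  uniformWeight-nonNeg : ∀ l → 0ℚ ℚ.≤ uniformWeight l
  uniformWeight-nonNeg l with hasDup? l
  ... | yes _ = ℚₚ.≤-refl
  ... | no _  = ℚₚ.nonNegative⁻¹ (injectiveWeight (length l)) {{injectiveWeight-nonNeg (length l)}}

  uniformWeight≡0⇒HasDup : ∀ l → length l ≤ n → uniformWeight l ≡ 0ℚ → HasDup l
  uniformWeight≡0⇒HasDup l l≤n w≡0 with hasDup? l
  ... | yes dup = dup
  ... | no _    = ⊥-elim (ℚₚ.<-irrefl (sym w≡0) (ℚₚ.positive⁻¹ _ {{injectiveWeight-pos (length l) l≤n}}))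

  ∑-∈ : ∀ b → ¬ HasDup b → ∑ (allFinL n) (λ v → 𝟙 (v ∈? b)) ≡ fromℕ (length b)
  ∑-∈ []      _    = ∑-zero (allFinL n) (λ v → 𝟙-no (v ∈? []) λ ())
  ∑-∈ (x ∷ b) ¬dup = begin
    ∑ (allFinL n) (λ v → 𝟙 (v ∈? (x ∷ b)))
      ≡⟨ ∑-cong (allFinL n) split ⟩
    ∑ (allFinL n) (λ v → 𝟙 (x Finₚ.≟ v) * 1ℚ + 𝟙 (v ∈? b))
      ≡⟨ ∑-+ (allFinL n) _ _ ⟩
    ∑ (allFinL n) (λ v → 𝟙 (x Finₚ.≟ v) * 1ℚ) + ∑ (allFinL n) (λ v → 𝟙 (v ∈? b))
      ≡⟨ cong₂ _+_ (∑-allFin-point n x (x Finₚ.≟_) (λ _ → 1ℚ)) (∑-∈ b (¬dup ∘ there)) ⟩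
    fromℕ (length (x ∷ b)) ∎
    where
      open ≡-Reasoning
      split′ : ∀ v (x≟v : Dec (x ≡ v)) (v∈?b : Dec (v ∈ b)) (v∈?xb : Dec (v ∈ x ∷ b)) →
               𝟙 v∈?xb ≡ 𝟙 x≟v * 1ℚ + 𝟙 v∈?b
      split′ v (yes x≡v) (yes v∈b) _     = ⊥-elim (¬dup (here (subst (_∈ b) (sym x≡v) v∈b)))
      split′ v (yes x≡v) (no _)    v∈?xb = 𝟙-yes v∈?xb (here (sym x≡v))
      split′ v (no _)    (yes v∈b) v∈?xb = trans (𝟙-yes v∈?xb (there v∈b)) (sym (trans (cong (_+ 1ℚ) (zeroˡ 1ℚ)) (+-identityˡ 1ℚ)))
      split′ v (no x≢v)  (no v∉b)  v∈?xb = trans (𝟙-no v∈?xb λ { (here v≡x) → x≢v (sym v≡x) ; (there v∈b) → v∉b v∈b })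
                                                 (sym (trans (+-identityʳ _) (zeroˡ 1ℚ)))
      split : ∀ v → 𝟙 (v ∈? (x ∷ b)) ≡ 𝟙 (x Finₚ.≟ v) * 1ℚ + 𝟙 (v ∈? b)
      split v = split′ v (x Finₚ.≟ v) (v ∈? b) (v ∈? (x ∷ b))

  -- Among the n letters exactly n - length b keep b injective, and each such extension has the next weight.
  uniformWeight-insert : ∀ b q → suc (length b) ≤ n → ∑ (allFinL n) (λ v → uniformWeight (insertAtℕ b q v)) ≡ uniformWeight b
  uniformWeight-insert b q b<n with hasDup? b
  ... | yes dup = ∑-zero (allFinL n) (λ v → uniformWeight-dup _ (HasDup-insertAtℕ⁺ b q v dup))
  ... | no ¬dup = begin
    ∑ (allFinL n) (λ v → uniformWeight (insertAtℕ b q v))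
      ≡⟨ ∑-cong (allFinL n) fresh ⟩
    ∑ (allFinL n) (λ v → 𝟙 (¬? (v ∈? b)) * next)
      ≡⟨ ∑-*ʳ (allFinL n) next _ ⟩
    ∑ (allFinL n) (λ v → 𝟙 (¬? (v ∈? b))) * next
      ≡⟨ cong (_* next) (trans (∑-cong (allFinL n) (λ v → 𝟙-¬ (v ∈? b))) (∑-sub (allFinL n) (λ _ → 1ℚ) _)) ⟩
    (∑ (allFinL n) (λ _ → 1ℚ) - ∑ (allFinL n) (λ v → 𝟙 (v ∈? b))) * next
      ≡⟨ cong (_* next) (cong₂ _-_ ∑-1 (∑-∈ b ¬dup)) ⟩
    (fromℕ n - fromℕ (length b)) * next
      ≡⟨ cong (_* next) (fromℕ-∸ (length b) (ℕₚ.<⇒≤ b<n)) ⟩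
    fromℕ (n ∸ length b) * next
      ≡⟨ injectiveWeight-suc (length b) b<n ⟩
    injectiveWeight (length b) ∎
    where
      open ≡-Reasoning
      next = injectiveWeight (suc (length b))
      fresh : ∀ v → uniformWeight (insertAtℕ b q v) ≡ 𝟙 (¬? (v ∈? b)) * next
      fresh v with hasDup? (insertAtℕ b q v) | v ∈? b
      ... | yes _   | yes _   = sym (zeroˡ next)
      ... | yes dup | no v∉b  = ⊥-elim ([ ¬dup , v∉b ]′ (HasDup-insertAtℕ⁻ b q v dup))
      ... | no ¬dup′ | yes v∈b = ⊥-elim (¬dup′ (∈⇒HasDup-insertAtℕ b q v v∈b))
      ... | no _    | no _    = trans (cong injectiveWeight (length-insertAtℕ b q v)) (sym (*-identityˡ next))

  uniformWeighting : ∀ k → k ≤ n → Weighting n k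
  uniformWeighting k k≤n = record
    { weight        = uniformWeight
    ; weight-[]     = refl
    ; weight-insert = λ b q _ b<k → uniformWeight-insert b q (ℕₚ.≤-trans b<k k≤n)
    ; weight-dup    = uniformWeight-dup
    }

open import Data.Nat using (_+_; _*_; _/_)

module ℚΣ = Summation ℚₚ.+-*-isCommutativeRing
module ℤΣ = Summation ℤₚ.+-*-isCommutativeRing

∑-nonNeg : ∀ {B : Set} (xs : List B) {f : B → ℚ} → (∀ x → 0ℚ ℚ.≤ f x) → 0ℚ ℚ.≤ ℚΣ.∑ xs f
∑-nonNeg []       f≥0 = ℚₚ.≤-refl
∑-nonNeg (x ∷ xs) f≥0 = ℚₚ.+-mono-≤ (f≥0 x) (∑-nonNeg xs f≥0)

nonNeg+nonNeg≡0⇒≡0 : ∀ {p q : ℚ} → 0ℚ ℚ.≤ p → 0ℚ ℚ.≤ q → p ℚ.+ q ≡ 0ℚ → p ≡ 0ℚ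
nonNeg+nonNeg≡0⇒≡0 {p} {q} p≥0 q≥0 p+q≡0 = ℚₚ.≤-antisym p≤0 p≥0
  where
    open ℚₚ.≤-Reasoning
    p≤0 : p ℚ.≤ 0ℚ
    p≤0 = begin
      p          ≡⟨ ℚₚ.+-identityʳ p ⟨
      p ℚ.+ 0ℚ   ≤⟨ ℚₚ.+-monoʳ-≤ p q≥0 ⟩
      p ℚ.+ q    ≡⟨ p+q≡0 ⟩
      0ℚ         ∎

∑-nonNeg≡0 : ∀ {B : Set} (xs : List B) {f : B → ℚ} → (∀ x → 0ℚ ℚ.≤ f x) → ℚΣ.∑ xs f ≡ 0ℚ → All (λ x → f x ≡ 0ℚ) xs
∑-nonNeg≡0 []       f≥0 _   = []
∑-nonNeg≡0 (x ∷ xs) {f} f≥0 ∑≡0 =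
  nonNeg+nonNeg≡0⇒≡0 (f≥0 x) (∑-nonNeg xs f≥0) ∑≡0 ∷
  ∑-nonNeg≡0 xs f≥0 (nonNeg+nonNeg≡0⇒≡0 (∑-nonNeg xs f≥0) (f≥0 x) (trans (ℚₚ.+-comm _ (f x)) ∑≡0))

∑-All≡0 : ∀ {B : Set} (xs : List B) {f : B → ℤ} → All (λ x → f x ≡ ℤ.+ 0) xs → ℤΣ.∑ xs f ≡ ℤ.+ 0
∑-All≡0 []       []           = refl
∑-All≡0 (x ∷ xs) (fx≡0 ∷ rest) = cong₂ ℤ._+_ fx≡0 (∑-All≡0 xs rest)

triangular*2 : ∀ k → triangular k * 2 ≡ k * k + k
triangular*2 zero    = refl
triangular*2 (suc k) = begin
  (suc k + triangular k) * 2   ≡⟨ ℕₚ.*-distribʳ-+ 2 (suc k) (triangular k) ⟩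
  suc k * 2 + triangular k * 2 ≡⟨ cong (suc k * 2 +_) (triangular*2 k) ⟩
  suc k * 2 + (k * k + k)      ≡⟨ expand k ⟩
  suc k * suc k + suc k        ∎
  where
    open ≡-Reasoning
    open +-*-Solver
    expand : ∀ k → suc k * 2 + (k * k + k) ≡ suc k * suc k + suc k
    expand = solve 1 (λ k → (con 1 :+ k) :* con 2 :+ (k :* k :+ k) := (con 1 :+ k) :* (con 1 :+ k) :+ (con 1 :+ k)) refl

triangular-closed : ∀ k → (k * k + k) / 2 ≡ triangular k
triangular-closed k = trans (cong (_/ 2) (sym (triangular*2 k))) (m*n/n≡m (triangular k) 2)

k≤triangular : ∀ k → k ≤ triangular k
k≤triangular zero    = ℕₚ.≤-refl
k≤triangular (suc k) = ℕₚ.m≤m+n (suc k) (triangular k)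

module Support (n k : ℕ) (k≤n : k ≤ n) (T[k]≤n : triangular k ≤ n) where
  open Weightings ℚₚ.+-*-isCommutativeRing using () renaming (module Marginals to ℚMarginals)
  open Weightings ℤₚ.+-*-isCommutativeRing using () renaming (module Marginals to ℤMarginals)
  open UniformWeights n
  open MarkerWeights ℤₚ.+-*-isCommutativeRing n using (markerWeighting; markerWeight; markerWeight-dup)
  module ℚM = ℚMarginals (uniformWeighting k k≤n)
  module ℤM = ℤMarginals (markerWeighting k T[k]≤n)

  𝟙-nonNeg : ∀ {P : Set} (p : Dec P) → 0ℚ ℚ.≤ ℚΣ.𝟙 p
  𝟙-nonNeg (yes _) = ℚₚ.nonNegative⁻¹ 1ℚ
  𝟙-nonNeg (no _)  = ℚₚ.≤-refl

  uniformWeight*𝟙-nonNeg : ∀ l {P : Set} (p : Dec P) → 0ℚ ℚ.≤ uniformWeight l ℚ.* ℚΣ.𝟙 p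
  uniformWeight*𝟙-nonNeg l p = ℚₚ.nonNegative⁻¹ _
    {{ℚₚ.nonNeg*nonNeg⇒nonNeg (uniformWeight l) {{ℚ.nonNegative (uniformWeight-nonNeg l)}}
                              (ℚΣ.𝟙 p) {{ℚ.nonNegative (𝟙-nonNeg p)}}}}

  marginal-nonNeg : ∀ m {p} (g : Vec (Fin m) p) a → 0ℚ ℚ.≤ ℚM.marginal m g a
  marginal-nonNeg m g a = ∑-nonNeg (allTuples n m) λ c → uniformWeight*𝟙-nonNeg (toList c) (sel c g ℚΣ.≟ᵥ a)

  marginal-support : ∀ m {p} (g : Vec (Fin m) p) a → m ≤ n → ℚM.marginal m g a ≡ 0ℚ → ℤM.marginal m g a ≡ ℤ.+ 0
  marginal-support m g a m≤n ℚ≡0 = ∑-All≡0 (allTuples n m)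
    (All.map (λ {c} → term c (sel c g ℚΣ.≟ᵥ a))
             (∑-nonNeg≡0 (allTuples n m) (λ c → uniformWeight*𝟙-nonNeg (toList c) (sel c g ℚΣ.≟ᵥ a)) ℚ≡0))
    where
      term : ∀ (c : Vec (Fin n) m) {P : Set} (p : Dec P) →
             uniformWeight (toList c) ℚ.* ℚΣ.𝟙 p ≡ 0ℚ → markerWeight (toList c) ℤ.* ℤΣ.𝟙 p ≡ ℤ.+ 0
      term c (no _)  _   = ℤₚ.*-zeroʳ (markerWeight (toList c))
      term c (yes _) w≡0 = cong (ℤ._* ℤ.+ 1) (markerWeight-dup (toList c) dup)
        where
          dup = uniformWeight≡0⇒HasDup (toList c) (ℕₚ.≤-trans (ℕₚ.≤-reflexive (Vecₚ.length-toList c)) m≤n)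
                                       (trans (sym (ℚₚ.*-identityʳ _)) w≡0)

BA-Yes-K : ∀ k n → 2 ≤ k → triangular k ≤ n → ∀ X → Loopless X → BA-Yes k X (K n)
BA-Yes-K k n 2≤k T[k]≤n X loopless =
  ℚS.patternMarginal , ℚS.patternMarginal , ℤS.patternMarginal , ℤS.patternMarginal ,
  ℚS.solves ,
  (λ x a → marginal-nonNeg _ (shape (orderPattern x)) a) ,
  (λ y b _ _ → marginal-nonNeg _ (shape (orderPattern y)) b) ,
  ℤS.solves ,
  (λ x a → marginal-support _ (shape (orderPattern x)) a (width≤n x ℕₚ.≤-refl)) ,
  (λ y b _ _ → marginal-support _ (shape (orderPattern y)) b (width≤n y 2≤k))
  where
    k≤n = ℕₚ.≤-trans (k≤triangular k) T[k]≤n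
    open Support n k k≤n T[k]≤n
    open OrderPattern
    module ℚS = Weightings.Solution ℚₚ.+-*-isCommutativeRing (UniformWeights.uniformWeighting n k k≤n) 2≤k X loopless
    module ℤS = Weightings.Solution ℤₚ.+-*-isCommutativeRing (MarkerWeights.markerWeighting ℤₚ.+-*-isCommutativeRing n k T[k]≤n) 2≤k X loopless
    width≤n : ∀ {p} (x : Tuple X p) → p ≤ k → width (orderPattern x) ≤ n
    width≤n x p≤k = ℕₚ.≤-trans (ℚS.width≤k x p≤k) k≤n

proposition2p6 : ∀ (k : ℕ) → 2 ≤ k → ∀ (X : Digraph) → Loopless X →
                 BA-Yes k X (K ((k * k + k) / 2))
proposition2p6 k 2≤k = BA-Yes-K k _ 2≤k (ℕₚ.≤-reflexive (sym (triangular-closed k)))
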